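{- Let $p$ be a prime and let $(\Omega,S)$ be a coherent configuration with fibers $\Omega_1,\dots,\Omega_m$ such that $(\Omega_i,S_i)\simeq C_p\wr C_p$ for each $i$, $n_s=p$ for each $s\in\bigcup_{i\ne j}S_{ij}$, and $S=\bigcup_{i=1}^mS_i\cup(S\setminus R)$ where $R$ is the set of regular elements of $S$. Fix $\alpha_i\in\Omega_i$ ($1\le i\le m$), $t_1\in\mathbf{O}_\theta(S_1)\setminus\{1_{\Omega_1}\}$, and for $i\ge2$ let $t_i$ be the unique element of $\mathbf{O}_\theta(S_i)$ with $r(\alpha_1t_1,\alpha_it_i)=r(\alpha_1,\alpha_i)$. For each $i$ let $\{\alpha_{ik}\mid k=1,\dots,p\}$ be a complete set of representatives of the equivalence relation $\bigcup_{t\in\mathbf{O}_\theta(S_i)}t$ on $\Omega_i$. For $s\in S_{ij}$ with $i\ne j$ and $k,l\in\{1,\dots,p\}$ let $h(s)_{kl}\in\mathbb{Z}_p$ be the unique element with $r(\alpha_{ik},\alpha_{jl}t_j^{h(s)_{kl}})=s$, and let $H(s):=(\xi^{h(s)_{kl}})_{k,l}\in M_{p\times p}(\mathbb{C})$, where $\xi$ is a fixed primitive $p$-th root of unity. Then for all distinct $i,j,k$ and all $s_1\in S_{ij}$, $s_2\in S_{jk}$, $s_3\in S_{ik}$, we have $H(s_1)H(s_2)=\alpha H(s_3)$ for some $\alpha\in\mathbb{C}$ with $|\alpha|=\sqrt{p}$.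
   Context: A coherent configuration is a pair $(\Omega,S)$ of a finite set $\Omega$ and a partition $S$ of $\Omega\times\Omega$ such that $1_\Omega$ is a union of elements of $S$, $s^\ast:=\{(\beta,\alpha)\mid(\alpha,\beta)\in s\}\in S$ for $s\in S$, and $\sigma_s\sigma_t=\sum_{u\in S}c_{st}^u\sigma_u$ with nonnegative integers $c_{st}^u$, where $\sigma_u$ is the adjacency matrix of $u$. Fibers are the sets $\Delta$ with $1_\Delta\in S$; they partition $\Omega$. $S_{ij}:=\{s\in S\mid s\subseteq\Omega_i\times\Omega_j\}$, $S_i:=S_{ii}$. For $s\in S_{ij}$, $n_s:=|\{\beta\mid(\alpha,\beta)\in s\}|$ for any $\alpha\in\Omega_i$. $\mathbf{O}_\theta(S_i):=\{t\in S_i\mid n_t=1\}$, a cyclic group of order $p$ under relational composition; for $u\in\mathbf{O}_\theta(S_i)$ and $\beta\in\Omega_i$, $\beta u$ is the unique $\gamma$ with $(\beta,\gamma)\in u$, and $t_i^a$ is the $a$-fold composition. $r(\alpha,\beta)$ is the unique element of $S$ containing $(\alpha,\beta)$. An element $s$ is regular if $ss^\ast s=\{s\}$, using the complex product $TU:=\{s\mid c_{tu}^s>0$ for some $t\in T,u\in U\}$. $C_p\wr C_p$ is the association scheme on $\mathbb{Z}_p\times\mathbb{Z}_p$ with relations $\{((x,y),(x+a,y))\}$ ($a\in\mathbb{Z}_p$) and $\{((x_1,y),(x_2,y+b))\}$ ($b\ne0$). -}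

module Defs where

open import Data.Nat using (ℕ; zero; suc; _+_; _*_; _∸_; _<_; NonZero)
open import Data.Nat.DivMod using (_%_)
open import Data.Fin using (Fin; toℕ; fromℕ<)
open import Data.Nat.DivMod using (m%n<n)
open import Data.Integer as ℤ using (ℤ)
open import Data.Bool using (Bool; true; false; if_then_else_; _∧_)
open import Data.Product using (Σ; ∃; _×_; _,_)
open import Data.Sum using (_⊎_)
open import Relation.Nullary using (¬_; Dec; yes; no)
open import Relation.Nullary.Decidable using (⌊_⌋)
open import Relation.Binary.PropositionalEquality using (_≡_)
open import Function.Bundles using (_⇔_)
import Data.Fin as F

count : ∀ {n} → (Fin n → Bool) → ℕ
count {zero}  f = 0
count {suc n} f = (if f F.zero then 1 else 0) + count (λ i → f (F.suc i))

-- Coherent configurations on Ω = Fin N with S indexed by Fin M.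
-- r α β is the unique element of S containing (α , β).

record CoherentConfiguration (N M : ℕ) : Set where
  field
    r    : Fin N → Fin N → Fin M
    nonempty : ∀ s → ∃ λ α → ∃ λ β → r α β ≡ s
    -- 1_Ω is a union of elements of S
    diag : ∀ α β γ → r β γ ≡ r α α → β ≡ γ
    star : Fin M → Fin M
    star-spec : ∀ α β → r β α ≡ star (r α β)
    c : Fin M → Fin M → Fin M → ℕ
    c-spec : ∀ s t α β →
      count (λ γ → ⌊ r α γ F.≟ s ⌋ ∧ ⌊ r γ β F.≟ t ⌋) ≡ c s t (r α β)

module _ {N M : ℕ} (X : CoherentConfiguration N M) where
  open CoherentConfiguration X

  -- fibers: a labelling fib : Ω → Fin m of the fibers {α | r α α = d}
  IsFiberLabelling : (m : ℕ) → (Fin N → Fin m) → Set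
  IsFiberLabelling m fib =
    (∀ i → ∃ λ α → fib α ≡ i) × (∀ α β → (fib α ≡ fib β) ⇔ (r α α ≡ r β β))

  In-S : ∀ {m} → (Fin N → Fin m) → Fin m → Fin m → Fin M → Set
  In-S fib i j s = ∀ α β → r α β ≡ s → (fib α ≡ i) × (fib β ≡ j)

  valency-at : Fin N → Fin M → ℕ
  valency-at α s = count (λ β → ⌊ r α β F.≟ s ⌋)

  InOθ : ∀ {m} → (Fin N → Fin m) → Fin m → Fin M → Set
  InOθ fib i t = In-S fib i i t × (∀ α → fib α ≡ i → valency-at α t ≡ 1)

  -- complex product membership: u ∈ {s}{s*}{s}
  InSSstarS : Fin M → Fin M → Set
  InSSstarS s u = ∃ λ v → (0 < c s (star s) v) × (0 < c v s u)

  Regular : Fin M → Set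
  Regular s = ∀ u → InSSstarS s u ⇔ (u ≡ s)

  Pow : Fin M → ℕ → Fin N → Fin N → Set
  Pow t zero    β γ = β ≡ γ
  Pow t (suc a) β γ = ∃ λ δ → (r β δ ≡ t) × Pow t a δ γ

-- The association scheme C_p ≀ C_p on ℤ_p × ℤ_p (ℤ_p = Fin p).
-- Two pairs of points lie in the same relation of C_p ≀ C_p.

module _ (p : ℕ) .{{_ : NonZero p}} where

  diffₚ : Fin p → Fin p → ℕ
  diffₚ a b = (toℕ b + (p ∸ toℕ a)) % p

  SameWrRel : (Fin p × Fin p) → (Fin p × Fin p) → (Fin p × Fin p) → (Fin p × Fin p) → Set
  SameWrRel (x₁ , y₁) (x₂ , y₂) (x₁' , y₁') (x₂' , y₂') =
      (y₁ ≡ y₂ × y₁' ≡ y₂' × diffₚ x₁ x₂ ≡ diffₚ x₁' x₂')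
    ⊎ (¬ y₁ ≡ y₂ × ¬ y₁' ≡ y₂' × diffₚ y₁ y₂ ≡ diffₚ y₁' y₂')

  -- The ring ℤ[ξ] ⊂ ℂ, ξ a primitive p-th root of unity (p prime):
  -- elements are coefficient vectors (a_0,…,a_{p-1}) representing
  -- Σ a_e ξ^e; two vectors represent the same complex number iff their
  -- difference is a multiple of 1 + ξ + … + ξ^{p-1} = 0 (Φ_p is the
  -- minimal polynomial of ξ).

  Zξ : Set
  Zξ = Fin p → ℤ

  _≈ξ_ : Zξ → Zξ → Set
  a ≈ξ b = ∃ λ (k : ℤ) → ∀ e → a e ≡ b e ℤ.+ k

  modp : ℕ → Fin p
  modp n = fromℕ< (m%n<n n p)

  ξ^ : ℕ → Zξ
  ξ^ a e = if ⌊ e F.≟ modp a ⌋ then ℤ.+ 1 else ℤ.+ 0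

  constξ : ℤ → Zξ
  constξ k e = if ⌊ e F.≟ modp 0 ⌋ then k else ℤ.+ 0

  _+ξ_ : Zξ → Zξ → Zξ
  (a +ξ b) e = a e ℤ.+ b e

  sumξ : ∀ {n} → (Fin n → Zξ) → Zξ
  sumξ {zero}  f = λ _ → ℤ.+ 0
  sumξ {suc n} f = f F.zero +ξ sumξ (λ i → f (F.suc i))

  sumℤ : ∀ {n} → (Fin n → ℤ) → ℤ
  sumℤ {zero}  f = ℤ.+ 0
  sumℤ {suc n} f = f F.zero ℤ.+ sumℤ (λ i → f (F.suc i))

  _*ξ_ : Zξ → Zξ → Zξ
  (a *ξ b) e = sumℤ (λ d → a d ℤ.* b (modp (toℕ e + (p ∸ toℕ d))))

  conjξ : Zξ → Zξ
  conjξ a e = a (modp (p ∸ toℕ e))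

  -- |α| = √p  ⇔  α ᾱ = p
  AbsIsSqrtP : Zξ → Set
  AbsIsSqrtP α = (α *ξ conjξ α) ≈ξ constξ (ℤ.+ p)

  Mat : Set
  Mat = Fin p → Fin p → Zξ

  Hmat : (Fin p → Fin p → Fin p) → Mat
  Hmat h k l = ξ^ (toℕ (h k l))

  _·M_ : Mat → Mat → Mat
  (A ·M B) k l = sumξ (λ q → A k q *ξ B q l)

module _ {N M : ℕ} (X : CoherentConfiguration N M) where
  open CoherentConfiguration X

  IsH : ∀ {p} → (rep-i rep-j : Fin p → Fin N) → (t-j : Fin M) → Fin M →
        (Fin p → Fin p → Fin p) → Set
  IsH rep-i rep-j t-j s h =
    ∀ k l → ∃ λ γ → Pow X t-j (toℕ (h k l)) (rep-j l) γ × (r (rep-i k) γ ≡ s)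

{-# OPTIONS --safe #-}
module Submission where

-- Each fibre Ω_i is a copy of C_p ≀ C_p: p blocks of p points, on which the thin relations
-- act by shifting points inside their blocks, t_i being the shift by some κ_i ≠ 0.  As no
-- s ∈ S_ij (i ≠ j) is regular, α s meets each block of Ω_j in exactly one point, which makes
-- h(s) well defined and forces the t_i to be compatible: r (β t_i) (δ t_j) = r β δ.  Counting
-- s₁s₂-paths then gives (H(s₁) H(s₂))_xy = Σ_e C(e ⊝ h(s₃)_xy) ξ^e for an intersection-number
-- valued C, i.e. H(s₁) H(s₂) = α H(s₃) with α = Σ_e C(e) ξ^e.  Finally, distinct rows of
-- h(s₂) agree after any shift in exactly one place, so Σ_d C(d) C(d ⊝ e) = p [e = 0] + p − 1,
-- which is α ᾱ = p.

open import Defs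
open import Data.Nat using (ℕ; suc; NonZero)
open import Data.Nat.Primality using (Prime; ¬prime[0]; ¬prime[1])
open import Data.Fin using (Fin; zero)
open import Data.Product using (Σ; ∃; _×_; _,_)
open import Data.Sum using (_⊎_)
open import Relation.Nullary using (¬_; contradiction)
open import Relation.Binary.PropositionalEquality using (_≡_)
open import Function.Bundles using (_⇔_)
open import Function.Definitions using (Injective)

module Counting where

  open import Data.Nat using (ℕ; zero; suc; _+_; _*_; _≤_; _<_; z≤n; s≤s)
  open import Data.Nat.Properties
  open import Data.Fin as F using (Fin; zero; suc)
  import Data.Fin.Properties as FP
  open import Data.Bool using (Bool; true; false; if_then_else_; _∧_; not)
  open import Data.Bool.Properties using (¬-not)
  open import Data.Product using (∃; _×_; _,_)
  open import Data.Empty using (⊥-elim)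
  open import Function using (_∘_)
  open import Relation.Nullary using (¬_; Dec; yes; no; contradiction)
  open import Relation.Nullary.Decidable using (⌊_⌋)
  open import Relation.Binary.PropositionalEquality
  open import Defs using (count)
  open import Algebra.Properties.Semiring.Sum +-*-semiring public
    using (sum; sum-cong-≗; sum-remove; ∑-comm; ∑-distrib-+; *-distribˡ-sum; *-distribʳ-sum)

  private variable n N : ℕ

  module _ {ℓ} {A : Set ℓ} where

    ⌊⌋≡true : (a? : Dec A) → A → ⌊ a? ⌋ ≡ true
    ⌊⌋≡true (yes _) _ = refl
    ⌊⌋≡true (no ¬a) a = contradiction a ¬a

    ⌊⌋≡false : (a? : Dec A) → ¬ A → ⌊ a? ⌋ ≡ false
    ⌊⌋≡false (yes a) ¬a = contradiction a ¬a
    ⌊⌋≡false (no _)  _  = refl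

    ⌊⌋≡true⁻¹ : (a? : Dec A) → ⌊ a? ⌋ ≡ true → A
    ⌊⌋≡true⁻¹ (yes a) _ = a

  ⌊⌋-⇔ : ∀ {ℓ ℓ′} {A : Set ℓ} {B : Set ℓ′} (a? : Dec A) (b? : Dec B) →
         (A → B) → (B → A) → ⌊ a? ⌋ ≡ ⌊ b? ⌋
  ⌊⌋-⇔ (yes a) b? f g = sym (⌊⌋≡true b? (f a))
  ⌊⌋-⇔ (no ¬a) b? f g = sym (⌊⌋≡false b? (¬a ∘ g))

  ∧-true⁻¹ : ∀ {a b} → a ∧ b ≡ true → a ≡ true × b ≡ true
  ∧-true⁻¹ {true} {true} _ = refl , refl

  ∧-true : ∀ {a b} → a ≡ true → b ≡ true → a ∧ b ≡ true
  ∧-true refl refl = refl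

  𝟙 : Bool → ℕ
  𝟙 b = if b then 1 else 0

  count≡∑𝟙 : (f : Fin n → Bool) → count f ≡ sum (𝟙 ∘ f)
  count≡∑𝟙 {zero}  f = refl
  count≡∑𝟙 {suc n} f = cong (𝟙 (f zero) +_) (count≡∑𝟙 (f ∘ suc))

  count-cong : {f g : Fin n → Bool} → (∀ i → f i ≡ g i) → count f ≡ count g
  count-cong {zero}  e = refl
  count-cong {suc n} e = cong₂ _+_ (cong 𝟙 (e zero)) (count-cong (e ∘ suc))

  sum-const : ∀ n c → sum {n} (λ _ → c) ≡ n * c
  sum-const zero    c = refl
  sum-const (suc n) c = cong (c +_) (sum-const n c)

  sum-cong-const : (f : Fin n → ℕ) → ∀ c → (∀ i → f i ≡ c) → sum f ≡ n * c
  sum-cong-const {n} f c h = trans (sum-cong-≗ h) (sum-const n c)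

  sum-*-sum : ∀ {m} (f : Fin n → ℕ) (g : Fin m → ℕ) → sum f * sum g ≡ sum (λ i → sum (λ j → f i * g j))
  sum-*-sum f g = trans (*-distribʳ-sum (sum g) f) (sum-cong-≗ (λ i → *-distribˡ-sum (f i) g))

  count-true : ∀ n → count {n} (λ _ → true) ≡ n
  count-true zero    = refl
  count-true (suc n) = cong suc (count-true n)

  sum-zero : (f : Fin n → ℕ) → (∀ i → f i ≡ 0) → sum f ≡ 0
  sum-zero {n} f h = trans (sum-cong-const f 0 h) (*-zeroʳ n)

  sum-single : (f : Fin n → ℕ) (k : Fin n) → (∀ q → ¬ q ≡ k → f q ≡ 0) → sum f ≡ f k
  sum-single f zero h =
    trans (cong (f zero +_) (sum-zero (f ∘ suc) (λ i → h (suc i) (λ ())))) (+-identityʳ _)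
  sum-single f (suc k) h rewrite h zero (λ ()) =
    sum-single (f ∘ suc) k (λ q q≢k → h (suc q) (q≢k ∘ FP.suc-injective))

  sum-sift : (a : Fin n) (f : Fin n → ℕ) → sum (λ d → 𝟙 ⌊ d F.≟ a ⌋ * f d) ≡ f a
  sum-sift a f =
    trans (sum-single _ a (λ d d≢a → cong (λ b → 𝟙 b * f d) (⌊⌋≡false (d F.≟ a) d≢a)))
          (trans (cong (λ b → 𝟙 b * f a) (⌊⌋≡true (a F.≟ a) refl)) (+-identityʳ (f a)))

  sum≤length : (f : Fin n → ℕ) → (∀ i → f i ≤ 1) → sum f ≤ n
  sum≤length {zero}  f h = z≤n
  sum≤length {suc n} f h = +-mono-≤ (h zero) (sum≤length (f ∘ suc) (h ∘ suc))

  sum≡length⇒all1 : (f : Fin n → ℕ) → (∀ i → f i ≤ 1) → sum f ≡ n → ∀ i → f i ≡ 1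
  sum≡length⇒all1 {suc n} f h eq i with f zero in e | h zero
  ... | 0 | _ = ⊥-elim (<-irrefl refl (≤-trans (≤-reflexive (sym eq)) (sum≤length (f ∘ suc) (h ∘ suc))))
  ... | 1 | _ with i
  ...   | zero  = e
  ...   | suc i = sum≡length⇒all1 (f ∘ suc) (h ∘ suc) (suc-injective eq) i
  sum≡length⇒all1 f h eq i | suc (suc _) | s≤s ()

  count>0⇒∃ : (f : Fin n → Bool) → 0 < count f → ∃ λ i → f i ≡ true
  count>0⇒∃ {suc n} f pos with f zero in e
  ... | true  = zero , e
  ... | false = let i , fi = count>0⇒∃ (f ∘ suc) pos in suc i , fi

  ∃⇒count>0 : (f : Fin n → Bool) (i : Fin n) → f i ≡ true → 0 < count f
  ∃⇒count>0 f zero    e rewrite e = s≤s z≤n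
  ∃⇒count>0 f (suc i) e = ≤-trans (∃⇒count>0 (f ∘ suc) i e) (m≤n+m _ (𝟙 (f zero)))

  count≡0⇒false : (f : Fin n → Bool) → count f ≡ 0 → ∀ i → f i ≡ false
  count≡0⇒false f c i = ¬-not (λ e → <-irrefl (sym c) (∃⇒count>0 f i e))

  count-false : (f : Fin n → Bool) → (∀ i → f i ≡ false) → count f ≡ 0
  count-false {zero}  f h = refl
  count-false {suc n} f h rewrite h zero = count-false (f ∘ suc) (h ∘ suc)

  count≡1 : (f : Fin n → Bool) (k : Fin n) → (∀ i → f i ≡ true → i ≡ k) → f k ≡ true → count f ≡ 1
  count≡1 f k unique fk =
    trans (count≡∑𝟙 f)
      (trans (sum-single _ k (λ q q≢k → cong 𝟙 (¬-not (q≢k ∘ unique q)))) (cong 𝟙 fk))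

  count≤1 : (f : Fin n → Bool) → (∀ i j → f i ≡ true → f j ≡ true → i ≡ j) → count f ≤ 1
  count≤1 {zero}  f unique = z≤n
  count≤1 {suc n} f unique with f zero in e
  ... | true  = ≤-reflexive (cong suc (count-false (f ∘ suc) λ i →
                  ¬-not (λ fi → contradiction (unique zero (suc i) e fi) λ ())))
  ... | false = count≤1 (f ∘ suc) (λ i j fi fj → FP.suc-injective (unique (suc i) (suc j) fi fj))

  count≡1⇒unique : (f : Fin n → Bool) → count f ≡ 1 → ∀ i j → f i ≡ true → f j ≡ true → i ≡ j
  count≡1⇒unique {suc n} f c i j fi fj with f zero in e
  count≡1⇒unique f c zero    zero    fi fj | true = refl
  count≡1⇒unique f c zero    (suc j) fi fj | true
    = contradiction (trans (sym fj) (count≡0⇒false (f ∘ suc) (suc-injective c) j)) λ ()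
  count≡1⇒unique f c (suc i) j       fi fj | true
    = contradiction (trans (sym fi) (count≡0⇒false (f ∘ suc) (suc-injective c) i)) λ ()
  count≡1⇒unique f c zero    j       fi fj | false = contradiction (trans (sym fi) e) λ ()
  count≡1⇒unique f c (suc i) zero    fi fj | false = contradiction (trans (sym fj) e) λ ()
  count≡1⇒unique f c (suc i) (suc j) fi fj | false = cong suc (count≡1⇒unique (f ∘ suc) c i j fi fj)

  count-split : (f g : Fin n → Bool) → count f ≡ count (λ x → g x ∧ f x) + count (λ x → f x ∧ not (g x))
  count-split {zero}  f g = refl
  count-split {suc n} f g with f zero | g zero | count-split (f ∘ suc) (g ∘ suc)
  ... | true  | true  | ih = cong suc ih
  ... | true  | false | ih = trans (cong suc ih) (sym (+-suc _ _))
  ... | false | true  | ih = ih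
  ... | false | false | ih = ih

  count-comm : ∀ {m} (f : Fin n → Fin m → Bool) →
    sum (λ x → count (λ y → f x y)) ≡ sum (λ y → count (λ x → f x y))
  count-comm f = trans (sum-cong-≗ (λ x → count≡∑𝟙 (f x)))
                 (trans (∑-comm (λ x y → 𝟙 (f x y))) (sym (sum-cong-≗ (λ y → count≡∑𝟙 (λ x → f x y)))))

  count-partition : (A : Fin N → Bool) (g : Fin N → Fin n) →
    count A ≡ sum (λ q → count (λ x → A x ∧ ⌊ g x F.≟ q ⌋))
  count-partition {zero}  {n} A g = sym (sum-zero {n} _ (λ _ → refl))
  count-partition {suc N} {n} A g =
    trans (cong₂ _+_ (sym head-term) (count-partition (A ∘ suc) (g ∘ suc)))
          (sym (∑-distrib-+ (λ q → 𝟙 (A zero ∧ ⌊ g zero F.≟ q ⌋)) _))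
    where
    head-term : sum (λ q → 𝟙 (A zero ∧ ⌊ g zero F.≟ q ⌋)) ≡ 𝟙 (A zero)
    head-term with A zero
    ... | false = sum-zero {n} _ (λ _ → refl)
    ... | true  = trans (sum-single _ (g zero) (λ q q≢ → cong 𝟙 (⌊⌋≡false (g zero F.≟ q) (q≢ ∘ sym))))
                        (cong 𝟙 (⌊⌋≡true (g zero F.≟ g zero) refl))

  injective⇒onto : (A : Fin N → Bool) (g : Fin N → Fin n) → count A ≡ n →
    (∀ x y → A x ≡ true → A y ≡ true → g x ≡ g y → x ≡ y) →
    ∀ q → ∃ λ x → A x ≡ true × g x ≡ q
  injective⇒onto A g cA inj q =
    let x , e      = count>0⇒∃ _ (subst (0 <_) (sym (fibres-singleton q)) (s≤s z≤n))
        Ax , gx≡q = ∧-true⁻¹ e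
    in x , Ax , ⌊⌋≡true⁻¹ (g x F.≟ q) gx≡q
    where
    fibres-singleton : ∀ q → count (λ x → A x ∧ ⌊ g x F.≟ q ⌋) ≡ 1
    fibres-singleton = sum≡length⇒all1 _
      (λ q → count≤1 _ λ x y ex ey →
        let Ax , gx = ∧-true⁻¹ ex ; Ay , gy = ∧-true⁻¹ ey
        in inj x y Ax Ay (trans (⌊⌋≡true⁻¹ (g x F.≟ q) gx) (sym (⌊⌋≡true⁻¹ (g y F.≟ q) gy))))
      (trans (sym (count-partition A g)) cA)

  count-bijection : (A : Fin N → Bool) (g : Fin n → Fin N) (g⁻¹ : Fin N → Fin n) →
    (∀ γ → A γ ≡ true → g (g⁻¹ γ) ≡ γ) → (∀ q → A (g q) ≡ true) → (∀ q → g⁻¹ (g q) ≡ q) →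
    ∀ (Q : Fin N → Bool) → count (λ γ → A γ ∧ Q γ) ≡ count (Q ∘ g)
  count-bijection {N} {n} A g g⁻¹ sec inA retr Q =
    trans (count-partition _ g⁻¹) (trans (sum-cong-≗ fibre) (sym (count≡∑𝟙 {n} (Q ∘ g))))
    where
    fibre⇒≡ : ∀ q γ → (A γ ∧ Q γ) ∧ ⌊ g⁻¹ γ F.≟ q ⌋ ≡ true → A γ ≡ true × Q γ ≡ true × γ ≡ g q
    fibre⇒≡ q γ e =
      let AQ , g⁻¹γ≡q = ∧-true⁻¹ e ; Aγ , Qγ = ∧-true⁻¹ AQ
      in Aγ , Qγ , trans (sym (sec γ Aγ)) (cong g (⌊⌋≡true⁻¹ (g⁻¹ γ F.≟ q) g⁻¹γ≡q))
    fibre : ∀ q → count (λ γ → (A γ ∧ Q γ) ∧ ⌊ g⁻¹ γ F.≟ q ⌋) ≡ 𝟙 (Q (g q))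
    fibre q with Q (g q) in Qgq
    ... | true  = count≡1 _ (g q) (λ γ e → let _ , _ , γ≡ = fibre⇒≡ q γ e in γ≡)
                    (∧-true (∧-true (inA q) Qgq) (⌊⌋≡true (g⁻¹ (g q) F.≟ q) (retr q)))
    ... | false = count-false _ λ γ → ¬-not λ e →
                    let _ , Qγ , γ≡ = fibre⇒≡ q γ e
                    in contradiction (trans (sym Qgq) (trans (cong Q (sym γ≡)) Qγ)) λ ()

  choose : ∀ {ℓ} {P : Fin n → Set ℓ} → (∀ x → Dec (P x)) → Fin n → Fin n
  choose P? default with FP.any? P?
  ... | yes (x , _) = x
  ... | no _        = default

  choose-spec : ∀ {ℓ} {P : Fin n → Set ℓ} (P? : ∀ x → Dec (P x)) default → ∃ P → P (choose P? default)
  choose-spec P? default ex with FP.any? P?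
  ... | yes (_ , px) = px
  ... | no ¬ex       = contradiction ex ¬ex

module ZMod (p′ : ℕ) where

  open import Data.Nat using (ℕ; zero; suc; _+_; _*_; _∸_; _<_)
  open import Data.Nat.Properties
  open import Data.Nat.DivMod
  open import Data.Nat.Divisibility using (_∣_; divides; m%n≡0⇒n∣m)
  open import Data.Nat.Primality using (Prime; euclidsLemma)
  open import Data.Fin using (Fin; zero; suc; toℕ)
  import Data.Fin.Properties as FP
  open import Data.Product using (∃; _,_)
  open import Data.Sum using (inj₁; inj₂)
  open import Relation.Nullary using (¬_; contradiction)
  open import Relation.Binary.PropositionalEquality hiding ([_])
  open import Defs using (modp)
  open Counting using (count-true; injective⇒onto)
  open import Data.Bool using (true)

  P : ℕ
  P = suc (suc p′)

  Z : Set
  Z = Fin P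

  infixl 6 _⊕_ _⊝_
  infixl 7 _⊗_

  0z 1z : Z
  0z = zero
  1z = suc zero

  opaque
    [_] : ℕ → Z
    [ n ] = modp P n

    [_]≡modp : ∀ n → [ n ] ≡ modp P n
    [ n ]≡modp = refl

    toℕ-[] : ∀ n → toℕ [ n ] ≡ n % P
    toℕ-[] n = FP.toℕ-fromℕ< (m%n<n n P)

  []-cong% : ∀ {m n} → m % P ≡ n % P → [ m ] ≡ [ n ]
  []-cong% {m} {n} e = FP.toℕ-injective (trans (toℕ-[] m) (trans e (sym (toℕ-[] n))))

  []-toℕ : ∀ a → [ toℕ a ] ≡ a
  []-toℕ a = FP.toℕ-injective (trans (toℕ-[] (toℕ a)) (m<n⇒m%n≡m (FP.toℕ<n a)))

  []-%ˡ+ : ∀ m n → [ m % P + n ] ≡ [ m + n ]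
  []-%ˡ+ m n = []-cong% (trans (%-distribˡ-+ (m % P) n P)
    (trans (cong (λ k → (k + n % P) % P) (m%n%n≡m%n m P)) (sym (%-distribˡ-+ m n P))))

  []-%ʳ+ : ∀ m n → [ m + n % P ] ≡ [ m + n ]
  []-%ʳ+ m n = trans (cong [_] (+-comm m (n % P))) (trans ([]-%ˡ+ n m) (cong [_] (+-comm n m)))

  []-%ˡ* : ∀ m n → [ m % P * n ] ≡ [ m * n ]
  []-%ˡ* m n = []-cong% (trans (%-distribˡ-* (m % P) n P)
    (trans (cong (λ k → (k * (n % P)) % P) (m%n%n≡m%n m P)) (sym (%-distribˡ-* m n P))))

  []-%ʳ* : ∀ m n → [ m * (n % P) ] ≡ [ m * n ]
  []-%ʳ* m n = trans (cong [_] (*-comm m (n % P))) (trans ([]-%ˡ* n m) (cong [_] (*-comm n m)))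

  opaque
    _⊕_ : Z → Z → Z
    a ⊕ b = [ toℕ a + toℕ b ]

    ⊖_ : Z → Z
    ⊖ a = [ P ∸ toℕ a ]

    _⊝_ : Z → Z → Z
    a ⊝ b = [ toℕ a + (P ∸ toℕ b) ]

    _⊗_ : Z → Z → Z
    a ⊗ b = [ toℕ a * toℕ b ]

    ⊖-def : ∀ a → ⊖ a ≡ [ P ∸ toℕ a ]
    ⊖-def a = refl

    ⊝-def : ∀ a b → a ⊝ b ≡ [ toℕ a + (P ∸ toℕ b) ]
    ⊝-def a b = refl

    ⊗-def : ∀ a b → a ⊗ b ≡ [ toℕ a * toℕ b ]
    ⊗-def a b = refl

    []-+ : ∀ m n → [ m + n ] ≡ [ m ] ⊕ [ n ]
    []-+ m n = sym (trans (cong [_] (cong₂ _+_ (toℕ-[] m) (toℕ-[] n))) (trans ([]-%ˡ+ m _) ([]-%ʳ+ m n)))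

    ⊕-comm : ∀ a b → a ⊕ b ≡ b ⊕ a
    ⊕-comm a b = cong [_] (+-comm (toℕ a) (toℕ b))

    ⊗-comm : ∀ a b → a ⊗ b ≡ b ⊗ a
    ⊗-comm a b = cong [_] (*-comm (toℕ a) (toℕ b))

    ⊕-assoc : ∀ a b c → (a ⊕ b) ⊕ c ≡ a ⊕ (b ⊕ c)
    ⊕-assoc a b c = begin
      [ toℕ [ toℕ a + toℕ b ] + toℕ c ] ≡⟨ cong (λ k → [ k + toℕ c ]) (toℕ-[] _) ⟩
      [ (toℕ a + toℕ b) % P + toℕ c ]   ≡⟨ []-%ˡ+ (toℕ a + toℕ b) (toℕ c) ⟩
      [ toℕ a + toℕ b + toℕ c ]         ≡⟨ cong [_] (+-assoc (toℕ a) (toℕ b) (toℕ c)) ⟩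
      [ toℕ a + (toℕ b + toℕ c) ]       ≡⟨ []-%ʳ+ (toℕ a) (toℕ b + toℕ c) ⟨
      [ toℕ a + (toℕ b + toℕ c) % P ]   ≡⟨ cong (λ k → [ toℕ a + k ]) (toℕ-[] _) ⟨
      [ toℕ a + toℕ [ toℕ b + toℕ c ] ] ∎
      where open ≡-Reasoning

    ⊗-distribˡ : ∀ a b c → a ⊗ (b ⊕ c) ≡ a ⊗ b ⊕ a ⊗ c
    ⊗-distribˡ a b c = begin
      [ toℕ a * toℕ [ toℕ b + toℕ c ] ]   ≡⟨ cong (λ k → [ toℕ a * k ]) (toℕ-[] _) ⟩
      [ toℕ a * ((toℕ b + toℕ c) % P) ]   ≡⟨ []-%ʳ* (toℕ a) (toℕ b + toℕ c) ⟩
      [ toℕ a * (toℕ b + toℕ c) ]         ≡⟨ cong [_] (*-distribˡ-+ (toℕ a) (toℕ b) (toℕ c)) ⟩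
      [ toℕ a * toℕ b + toℕ a * toℕ c ]   ≡⟨ []-+ (toℕ a * toℕ b) (toℕ a * toℕ c) ⟩
      [ toℕ a * toℕ b ] ⊕ [ toℕ a * toℕ c ] ∎
      where open ≡-Reasoning

    ⊕-identityʳ : ∀ a → a ⊕ 0z ≡ a
    ⊕-identityʳ a = trans (cong [_] (+-identityʳ (toℕ a))) ([]-toℕ a)

    ⊗-identityˡ : ∀ a → 1z ⊗ a ≡ a
    ⊗-identityˡ a = trans (cong [_] (+-identityʳ (toℕ a))) ([]-toℕ a)

    ⊗-zeroˡ : ∀ a → 0z ⊗ a ≡ 0z
    ⊗-zeroˡ a = []-toℕ 0z

    ⊕-inverseʳ : ∀ a → a ⊕ ⊖ a ≡ 0z
    ⊕-inverseʳ a = begin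
      [ toℕ a + toℕ [ P ∸ toℕ a ] ] ≡⟨ cong (λ k → [ toℕ a + k ]) (toℕ-[] _) ⟩
      [ toℕ a + (P ∸ toℕ a) % P ]   ≡⟨ []-%ʳ+ (toℕ a) (P ∸ toℕ a) ⟩
      [ toℕ a + (P ∸ toℕ a) ]       ≡⟨ cong [_] (m+[n∸m]≡n (<⇒≤ (FP.toℕ<n a))) ⟩
      [ P ]                         ≡⟨ []-cong% {P} {0} (n%n≡0 P) ⟩
      [ 0 ]                         ≡⟨ []-toℕ 0z ⟩
      0z                            ∎
      where open ≡-Reasoning

    ⊝≡⊕⊖ : ∀ a b → a ⊝ b ≡ a ⊕ ⊖ b
    ⊝≡⊕⊖ a b = sym (trans (cong (λ k → [ toℕ a + k ]) (toℕ-[] _)) ([]-%ʳ+ (toℕ a) (P ∸ toℕ b)))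

  ⊕-identityˡ : ∀ a → 0z ⊕ a ≡ a
  ⊕-identityˡ a = trans (⊕-comm 0z a) (⊕-identityʳ a)

  ⊗-distribʳ : ∀ a b c → (a ⊕ b) ⊗ c ≡ a ⊗ c ⊕ b ⊗ c
  ⊗-distribʳ a b c = trans (⊗-comm _ c) (trans (⊗-distribˡ c a b) (cong₂ _⊕_ (⊗-comm c a) (⊗-comm c b)))

  a⊕b⊝b≡a : ∀ a b → a ⊕ b ⊝ b ≡ a
  a⊕b⊝b≡a a b = begin
    a ⊕ b ⊝ b       ≡⟨ ⊝≡⊕⊖ _ b ⟩
    a ⊕ b ⊕ ⊖ b     ≡⟨ ⊕-assoc a b _ ⟩
    a ⊕ (b ⊕ ⊖ b)   ≡⟨ cong (a ⊕_) (⊕-inverseʳ b) ⟩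
    a ⊕ 0z          ≡⟨ ⊕-identityʳ a ⟩
    a               ∎
    where open ≡-Reasoning

  a⊝b⊕b≡a : ∀ a b → a ⊝ b ⊕ b ≡ a
  a⊝b⊕b≡a a b = begin
    a ⊝ b ⊕ b       ≡⟨ cong (_⊕ b) (⊝≡⊕⊖ a b) ⟩
    a ⊕ ⊖ b ⊕ b     ≡⟨ ⊕-assoc a _ b ⟩
    a ⊕ (⊖ b ⊕ b)   ≡⟨ cong (a ⊕_) (trans (⊕-comm _ b) (⊕-inverseʳ b)) ⟩
    a ⊕ 0z          ≡⟨ ⊕-identityʳ a ⟩
    a               ∎
    where open ≡-Reasoning

  a⊕[b⊝a]≡b : ∀ a b → a ⊕ (b ⊝ a) ≡ b
  a⊕[b⊝a]≡b a b = trans (⊕-comm a _) (a⊝b⊕b≡a b a)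

  ⊝-self : ∀ a → a ⊝ a ≡ 0z
  ⊝-self a = trans (⊝≡⊕⊖ a a) (⊕-inverseʳ a)

  ⊝-identityʳ : ∀ a → a ⊝ 0z ≡ a
  ⊝-identityʳ a = trans (cong (_⊝ 0z) (sym (⊕-identityʳ a))) (a⊕b⊝b≡a a 0z)

  ⊕-cancelʳ : ∀ a b c → a ⊕ c ≡ b ⊕ c → a ≡ b
  ⊕-cancelʳ a b c e = trans (sym (a⊕b⊝b≡a a c)) (trans (cong (_⊝ c) e) (a⊕b⊝b≡a b c))

  ⊝≡⇒≡⊕ : ∀ {a b c} → a ⊝ b ≡ c → a ≡ c ⊕ b
  ⊝≡⇒≡⊕ {a} {b} e = trans (sym (a⊝b⊕b≡a a b)) (cong (_⊕ b) e)

  ≡⊕⇒⊝≡ : ∀ {a b c} → a ≡ c ⊕ b → a ⊝ b ≡ c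
  ≡⊕⇒⊝≡ {a} {b} {c} e = trans (cong (_⊝ b) e) (a⊕b⊝b≡a c b)

  ⊝≡0⇒≡ : ∀ a b → a ⊝ b ≡ 0z → a ≡ b
  ⊝≡0⇒≡ a b e = trans (⊝≡⇒≡⊕ e) (⊕-identityˡ b)

  ⊕≡⇒≡⊝ : ∀ a b x → a ⊕ x ≡ b → x ≡ b ⊝ a
  ⊕≡⇒≡⊝ a b x e = sym (≡⊕⇒⊝≡ (trans (sym e) (⊕-comm a x)))

  ⊝≡self⇒≡0 : ∀ a b → a ⊝ b ≡ a → b ≡ 0z
  ⊝≡self⇒≡0 a b e = ⊕-cancelʳ b 0z a (trans (⊕-comm b a) (trans (sym (⊝≡⇒≡⊕ e)) (sym (⊕-identityˡ a))))

  ⊕-⊝-assoc : ∀ a b c → a ⊕ (b ⊝ c) ≡ a ⊕ b ⊝ c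
  ⊕-⊝-assoc a b c = trans (cong (a ⊕_) (⊝≡⊕⊖ b c)) (trans (sym (⊕-assoc a b _)) (sym (⊝≡⊕⊖ (a ⊕ b) c)))

  ⊕≡0⇒⊖≡ : ∀ a b → a ⊕ b ≡ 0z → ⊖ a ≡ b
  ⊕≡0⇒⊖≡ a b a⊕b≡0 = begin
    ⊖ a                ≡⟨ ⊕-identityʳ (⊖ a) ⟨
    ⊖ a ⊕ 0z           ≡⟨ cong (⊖ a ⊕_) a⊕b≡0 ⟨
    ⊖ a ⊕ (a ⊕ b)      ≡⟨ ⊕-assoc (⊖ a) a b ⟨
    ⊖ a ⊕ a ⊕ b        ≡⟨ cong (_⊕ b) (trans (⊕-comm (⊖ a) a) (⊕-inverseʳ a)) ⟩
    0z ⊕ b             ≡⟨ ⊕-identityˡ b ⟩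
    b                  ∎
    where open ≡-Reasoning

  ⊖-⊝ : ∀ a b → ⊖ (a ⊝ b) ≡ b ⊝ a
  ⊖-⊝ a b = ⊕≡0⇒⊖≡ (a ⊝ b) (b ⊝ a)
    (trans (⊕-⊝-assoc (a ⊝ b) b a) (trans (cong (_⊝ a) (a⊝b⊕b≡a a b)) (⊝-self a)))

  ⊗-distribʳ-⊝ : ∀ a b c → (a ⊝ b) ⊗ c ≡ a ⊗ c ⊝ b ⊗ c
  ⊗-distribʳ-⊝ a b c = ⊕≡⇒≡⊝ (b ⊗ c) (a ⊗ c) ((a ⊝ b) ⊗ c)
    (trans (⊕-comm (b ⊗ c) _) (trans (sym (⊗-distribʳ (a ⊝ b) b c)) (cong (_⊗ c) (a⊝b⊕b≡a a b))))

  [0]⊗ : ∀ c → [ 0 ] ⊗ c ≡ 0z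
  [0]⊗ c = trans (cong (_⊗ c) ([]-toℕ 0z)) (⊗-zeroˡ c)

  [suc]⊗ : ∀ n c → [ suc n ] ⊗ c ≡ [ n ] ⊗ c ⊕ c
  [suc]⊗ n c = begin
    [ suc n ] ⊗ c          ≡⟨ cong (λ k → [ k ] ⊗ c) (+-comm 1 n) ⟩
    [ n + 1 ] ⊗ c          ≡⟨ cong (_⊗ c) (trans ([]-+ n 1) (cong ([ n ] ⊕_) ([]-toℕ 1z))) ⟩
    ([ n ] ⊕ 1z) ⊗ c       ≡⟨ ⊗-distribʳ [ n ] 1z c ⟩
    [ n ] ⊗ c ⊕ 1z ⊗ c     ≡⟨ cong ([ n ] ⊗ c ⊕_) (⊗-identityˡ c) ⟩
    [ n ] ⊗ c ⊕ c          ∎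
    where open ≡-Reasoning

  P∣x<P⇒x≡0 : ∀ {x} → P ∣ x → x < P → x ≡ 0
  P∣x<P⇒x≡0 (divides zero    refl) _   = refl
  P∣x<P⇒x≡0 (divides (suc k) refl) x<P = contradiction x<P (≤⇒≯ (m≤m+n P (k * P)))

  toℕ≡0 : ∀ {a : Z} → toℕ a ≡ 0 → a ≡ 0z
  toℕ≡0 = FP.toℕ-injective

  module _ (prime : Prime P) where

    ⊗-noZeroDivisors : ∀ a c → ¬ c ≡ 0z → a ⊗ c ≡ 0z → a ≡ 0z
    ⊗-noZeroDivisors a c c≢0 e with euclidsLemma (toℕ a) (toℕ c) prime P∣a*c
      where
      P∣a*c : P ∣ toℕ a * toℕ c
      P∣a*c = m%n≡0⇒n∣m _ P (trans (sym (toℕ-[] _)) (trans (cong toℕ (sym (⊗-def a c))) (cong toℕ e)))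
    ... | inj₁ P∣a = toℕ≡0 (P∣x<P⇒x≡0 P∣a (FP.toℕ<n a))
    ... | inj₂ P∣c = contradiction (toℕ≡0 (P∣x<P⇒x≡0 P∣c (FP.toℕ<n c))) c≢0

    ⊗-cancelʳ : ∀ a b c → ¬ c ≡ 0z → a ⊗ c ≡ b ⊗ c → a ≡ b
    ⊗-cancelʳ a b c c≢0 e = ⊝≡0⇒≡ a b (⊗-noZeroDivisors (a ⊝ b) c c≢0
      (trans (⊗-distribʳ-⊝ a b c) (trans (cong (_⊝ b ⊗ c) e) (⊝-self (b ⊗ c)))))

    ⊗-divide : ∀ c → ¬ c ≡ 0z → ∀ e → ∃ λ m → m ⊗ c ≡ e
    ⊗-divide c c≢0 e =
      let m , _ , mc≡e = injective⇒onto (λ _ → true) (_⊗ c) (count-true P)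
                           (λ x y _ _ → ⊗-cancelʳ x y c c≢0) e
      in m , mc≡e

    -- Every element is a multiple of the nonzero d.
    ⊕-induction : ∀ {ℓ} (Q : Z → Set ℓ) d → ¬ d ≡ 0z → Q 0z → (∀ x → Q x → Q (x ⊕ d)) → ∀ x → Q x
    ⊕-induction Q d d≢0 base step x =
      let m , md≡x = ⊗-divide d d≢0 x
      in subst Q (trans (cong (_⊗ d) ([]-toℕ m)) md≡x) (multiples (toℕ m))
      where
      multiples : ∀ n → Q ([ n ] ⊗ d)
      multiples zero    = subst Q (sym ([0]⊗ d)) base
      multiples (suc n) = subst Q (sym ([suc]⊗ n d)) (step _ (multiples n))

  private
    regroup : ∀ c d b e → c ⊕ (d ⊕ e ⊝ b) ≡ c ⊕ d ⊕ e ⊝ b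
    regroup c d b e = trans (⊕-⊝-assoc c (d ⊕ e) b) (cong (_⊝ b) (sym (⊕-assoc c d e)))

  ⊕⊝≡⊕⇒ : ∀ a b c d e → a ⊕ b ⊝ e ≡ c ⊕ d → a ≡ c ⊕ (d ⊕ e ⊝ b)
  ⊕⊝≡⊕⇒ a b c d e h = trans (sym (≡⊕⇒⊝≡ (sym (⊝≡⇒≡⊕ h)))) (sym (regroup c d b e))

  ⇒⊕⊝≡⊕ : ∀ a b c d e → a ≡ c ⊕ (d ⊕ e ⊝ b) → a ⊕ b ⊝ e ≡ c ⊕ d
  ⇒⊕⊝≡⊕ a b c d e h = ≡⊕⇒⊝≡ (sym (⊝≡⇒≡⊕ (sym (trans h (regroup c d b e)))))

module Configuration {N M : ℕ} (X : CoherentConfiguration N M) where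

  open import Data.Nat using (_<_)
  import Data.Fin as F
  open import Data.Product using (∃; _×_; _,_)
  open import Relation.Binary.PropositionalEquality
  open Counting

  open CoherentConfiguration X

  path⇒c>0 : ∀ {α β γ s t} → r α γ ≡ s → r γ β ≡ t → 0 < c s t (r α β)
  path⇒c>0 {α} {β} {γ} {s} {t} αγ βγ = subst (0 <_) (c-spec s t α β)
    (∃⇒count>0 _ γ (∧-true (⌊⌋≡true (r α γ F.≟ s) αγ) (⌊⌋≡true (r γ β F.≟ t) βγ)))

  c>0⇒path : ∀ {α β s t} → 0 < c s t (r α β) → ∃ λ γ → r α γ ≡ s × r γ β ≡ t
  c>0⇒path {α} {β} {s} {t} pos =
    let γ , e   = count>0⇒∃ _ (subst (0 <_) (sym (c-spec s t α β)) pos)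
        αγ , γβ = ∧-true⁻¹ e
    in γ , ⌊⌋≡true⁻¹ (r α γ F.≟ s) αγ , ⌊⌋≡true⁻¹ (r γ β F.≟ t) γβ

  star-involutive : ∀ s → star (star s) ≡ s
  star-involutive s =
    let α , β , αβ = nonempty s
    in trans (cong star (trans (cong star (sym αβ)) (sym (star-spec α β)))) (trans (sym (star-spec β α)) αβ)

  r-star : ∀ {α β s} → r α β ≡ s → r β α ≡ star s
  r-star {α} {β} e = trans (star-spec α β) (cong star e)

  r-flip : ∀ {α β α′ β′} → r α β ≡ r α′ β′ → r β α ≡ r β′ α′
  r-flip e = trans (r-star e) (sym (r-star refl))

  r-extendʳ : ∀ {α β α′ β′ β₁ β₁′ τ} → r α β ≡ r α′ β′ → r β β₁ ≡ τ →
              (∀ γ → r β′ γ ≡ τ → γ ≡ β₁′) → r α β₁ ≡ r α′ β₁′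
  r-extendʳ {α} {β} {α′} {β′} {β₁} {β₁′} {τ} e ββ₁ unique =
    let pos          = path⇒c>0 {α} {β} {β₁} refl (r-star ββ₁)
        γ , α′γ , γβ′ = c>0⇒path {α′} {β′} (subst (λ z → 0 < c (r α β₁) (star τ) z) e pos)
    in sym (subst (λ z → r α′ z ≡ r α β₁) (unique γ (trans (r-star γβ′) (star-involutive τ))) α′γ)

  r-extendˡ : ∀ {α β α′ β′ α₁ α₁′ τ} → r α β ≡ r α′ β′ → r α α₁ ≡ τ →
              (∀ γ → r α′ γ ≡ τ → γ ≡ α₁′) → r α₁ β ≡ r α₁′ β′
  r-extendˡ e αα₁ unique = r-flip (r-extendʳ (r-flip e) αα₁ unique)

  successor-exists : ∀ {β δ β′ u} → r β δ ≡ u → r β β ≡ r β′ β′ → ∃ λ δ′ → r β′ δ′ ≡ u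
  successor-exists {β} {δ} {β′} {u} βδ ββ′ =
    let δ′ , β′δ′ , _ = c>0⇒path {β′} {β′} (subst (λ z → 0 < c u (star u) z) ββ′ (path⇒c>0 βδ (r-star βδ)))
    in δ′ , β′δ′

  r≡⇒target-diagonal : ∀ {β δ β′ δ′} → r β δ ≡ r β′ δ′ → r δ δ ≡ r δ′ δ′
  r≡⇒target-diagonal {β} {δ} {β′} {δ′} e =
    let pos            = path⇒c>0 {δ} {β} {δ} refl (r-star refl)
        γ , δ′γ , _    = c>0⇒path {δ′} {β′} (subst (λ z → 0 < c (r δ δ) (star (r β δ)) z) (r-flip e) pos)
    in sym (subst (λ z → r δ′ z ≡ r δ δ) (sym (diag δ δ′ γ δ′γ)) δ′γ)

  r≡⇒source-diagonal : ∀ {β δ β′ δ′} → r β δ ≡ r β′ δ′ → r β β ≡ r β′ β′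
  r≡⇒source-diagonal e = r≡⇒target-diagonal (r-flip e)

  thin-successor-unique : ∀ {α t γ γ′} → valency-at X α t ≡ 1 → r α γ ≡ t → r α γ′ ≡ t → γ ≡ γ′
  thin-successor-unique {α} {t} {γ} {γ′} v αγ αγ′ =
    count≡1⇒unique _ v γ γ′ (⌊⌋≡true (r α γ F.≟ t) αγ) (⌊⌋≡true (r α γ′ F.≟ t) αγ′)

module Autocorrelation (p′ : ℕ) where

  open import Data.Nat using (suc; _+_; _*_)
  open import Data.Nat.Properties using (+-identityʳ; *-identityʳ; *-cancelˡ-≡)
  open import Data.Fin as F using (Fin)
  open import Data.Fin.Properties using (punchInᵢ≢i)
  open import Data.Bool using (Bool; true; false; if_then_else_)
  open import Function using (_∘_)
  open import Data.Vec.Functional using (removeAt)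
  open import Relation.Nullary using (¬_)
  open import Relation.Nullary.Decidable using (⌊_⌋)
  open import Relation.Binary.PropositionalEquality hiding ([_])
  open import Defs using (count)
  open Counting
  open ZMod p′

  δ₀ : Z → ℕ
  δ₀ e = if ⌊ e F.≟ 0z ⌋ then P else 0

  count-const : ∀ b → count {P} (λ _ → b) ≡ (if b then P else 0)
  count-const true  = count-true P
  count-const false = count-false {P} _ (λ _ → refl)

  module _ (C : Z → ℕ) (G : Fin P → Fin P → Z) (z : Fin P → Z)
    (column-count : ∀ y d → count (λ q → ⌊ z y ⊕ d F.≟ G y q ⌋) ≡ C d)
    (shifted-rows-meet-once : ∀ q q′ → ¬ q ≡ q′ → ∀ e → count (λ y → ⌊ G y q ⊝ e F.≟ G y q′ ⌋) ≡ 1)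
    where

    private
      meets : Z → Fin P → Fin P → Fin P → Bool
      meets e q q′ y = ⌊ G y q ⊝ e F.≟ G y q′ ⌋

    ∑𝟙*𝟙-shift : ∀ c a b e →
      sum (λ d → 𝟙 ⌊ c ⊕ d F.≟ a ⌋ * 𝟙 ⌊ c ⊕ (d ⊝ e) F.≟ b ⌋) ≡ 𝟙 ⌊ a ⊝ e F.≟ b ⌋
    ∑𝟙*𝟙-shift c a b e = begin
      sum term                                  ≡⟨ sum-single term (a ⊝ c) off-diagonal ⟩
      𝟙 ⌊ c ⊕ (a ⊝ c) F.≟ a ⌋ * 𝟙 ⌊ c ⊕ (a ⊝ c ⊝ e) F.≟ b ⌋
        ≡⟨ cong (λ x → 𝟙 x * 𝟙 ⌊ c ⊕ (a ⊝ c ⊝ e) F.≟ b ⌋) (⌊⌋≡true (c ⊕ (a ⊝ c) F.≟ a) (a⊕[b⊝a]≡b c a)) ⟩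
      𝟙 ⌊ c ⊕ (a ⊝ c ⊝ e) F.≟ b ⌋ + 0          ≡⟨ +-identityʳ _ ⟩
      𝟙 ⌊ c ⊕ (a ⊝ c ⊝ e) F.≟ b ⌋              ≡⟨ cong (λ x → 𝟙 ⌊ x F.≟ b ⌋) (⊕-⊝-assoc c (a ⊝ c) e) ⟩
      𝟙 ⌊ c ⊕ (a ⊝ c) ⊝ e F.≟ b ⌋              ≡⟨ cong (λ x → 𝟙 ⌊ x ⊝ e F.≟ b ⌋) (a⊕[b⊝a]≡b c a) ⟩
      𝟙 ⌊ a ⊝ e F.≟ b ⌋                        ∎
      where
      open ≡-Reasoning
      term : Z → ℕ
      term d = 𝟙 ⌊ c ⊕ d F.≟ a ⌋ * 𝟙 ⌊ c ⊕ (d ⊝ e) F.≟ b ⌋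
      off-diagonal : ∀ d → ¬ d ≡ a ⊝ c → term d ≡ 0
      off-diagonal d d≢ = cong (λ x → 𝟙 x * 𝟙 ⌊ c ⊕ (d ⊝ e) F.≟ b ⌋) (⌊⌋≡false (c ⊕ d F.≟ a) (d≢ ∘ ⊕≡⇒≡⊝ c a d))

    -- In column y, C d * C (d ⊝ e) counts the pairs (q , q′) with G y q = z y ⊕ d and G y q′ = z y ⊕ (d ⊝ e).
    autocorrelation-in-column : ∀ y e →
      sum (λ d → C d * C (d ⊝ e)) ≡ sum (λ q → count (λ q′ → meets e q q′ y))
    autocorrelation-in-column y e = begin
      sum (λ d → C d * C (d ⊝ e))
        ≡⟨ sum-cong-≗ (λ d → trans (cong₂ _*_ (column d) (column (d ⊝ e))) (sum-*-sum (hits d) (hits (d ⊝ e)))) ⟩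
      sum (λ d → sum (λ q → sum (λ q′ → pair d q q′)))
        ≡⟨ ∑-comm (λ d q → sum (λ q′ → pair d q q′)) ⟩
      sum (λ q → sum (λ d → sum (λ q′ → pair d q q′)))
        ≡⟨ sum-cong-≗ (λ q → trans (∑-comm (λ d q′ → pair d q q′))
                                   (sum-cong-≗ (λ q′ → ∑𝟙*𝟙-shift (z y) (G y q) (G y q′) e))) ⟩
      sum (λ q → sum (λ q′ → 𝟙 (meets e q q′ y)))
        ≡⟨ sum-cong-≗ (λ q → sym (count≡∑𝟙 (λ q′ → meets e q q′ y))) ⟩
      sum (λ q → count (λ q′ → meets e q q′ y))
        ∎
      where
      open ≡-Reasoning
      hits : Z → Fin P → ℕ
      hits d q = 𝟙 ⌊ z y ⊕ d F.≟ G y q ⌋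
      pair : Z → Fin P → Fin P → ℕ
      pair d q q′ = hits d q * hits (d ⊝ e) q′
      column : ∀ d → C d ≡ sum (hits d)
      column d = trans (sym (column-count y d)) (count≡∑𝟙 (λ q → ⌊ z y ⊕ d F.≟ G y q ⌋))

    row-total : ∀ e q → sum (λ q′ → count (meets e q q′)) ≡ δ₀ e + suc p′
    row-total e q = begin
      sum (λ q′ → count (meets e q q′))
        ≡⟨ sum-remove {i = q} (λ q′ → count (meets e q q′)) ⟩
      count (meets e q q) + sum (removeAt (λ q′ → count (meets e q q′)) q)
        ≡⟨ cong₂ _+_ diagonal (sum-cong-const _ 1 (λ j → shifted-rows-meet-once q _ (punchInᵢ≢i q j ∘ sym) e)) ⟩
      δ₀ e + suc p′ * 1
        ≡⟨ cong (δ₀ e +_) (*-identityʳ (suc p′)) ⟩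
      δ₀ e + suc p′
        ∎
      where
      open ≡-Reasoning
      diagonal : count (meets e q q) ≡ δ₀ e
      diagonal = trans (count-cong (λ y → ⌊⌋-⇔ (G y q ⊝ e F.≟ G y q) (e F.≟ 0z)
                   (⊝≡self⇒≡0 _ e) (λ e≡0 → trans (cong (G y q ⊝_) e≡0) (⊝-identityʳ _))))
                   (count-const ⌊ e F.≟ 0z ⌋)

    autocorrelation : ∀ e → sum (λ d → C d * C (d ⊝ e)) ≡ δ₀ e + suc p′
    autocorrelation e = *-cancelˡ-≡ _ _ P (begin
      P * ∑CC
        ≡⟨ sum-const P ∑CC ⟨
      sum {P} (λ _ → ∑CC)
        ≡⟨ sum-cong-≗ (λ y → autocorrelation-in-column y e) ⟩
      sum (λ y → sum (λ q → count (λ q′ → meets e q q′ y)))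
        ≡⟨ ∑-comm (λ y q → count (λ q′ → meets e q q′ y)) ⟩
      sum (λ q → sum (λ y → count (λ q′ → meets e q q′ y)))
        ≡⟨ sum-cong-≗ (λ q → trans (count-comm (λ y q′ → meets e q q′ y)) (row-total e q)) ⟩
      sum {P} (λ _ → δ₀ e + suc p′)
        ≡⟨ sum-const P (δ₀ e + suc p′) ⟩
      P * (δ₀ e + suc p′)
        ∎)
      where
      open ≡-Reasoning
      ∑CC : ℕ
      ∑CC = sum (λ d → C d * C (d ⊝ e))

module Cyclotomic (p′ : ℕ) where

  open import Data.Nat using (zero; suc; _*_)
  import Data.Nat as ℕ
  open import Data.Nat.Properties using (*-comm)
  open import Data.Integer using (ℤ; +_) renaming (_+_ to _+ℤ_; _*_ to _*ℤ_)
  import Data.Integer.Properties as ℤP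
  open import Data.Fin as F using (Fin; zero; suc; toℕ)
  open import Data.Bool using (true; false)
  open import Function using (_∘_)
  open import Relation.Nullary.Decidable using (⌊_⌋)
  open import Relation.Binary.PropositionalEquality hiding ([_])
  open import Defs
  open Counting
  open ZMod p′
  open Autocorrelation p′ using (δ₀)

  private variable n : ℕ

  sumℤ-cong : {f g : Fin n → ℤ} → (∀ i → f i ≡ g i) → sumℤ P f ≡ sumℤ P g
  sumℤ-cong {zero}  h = refl
  sumℤ-cong {suc n} h = cong₂ _+ℤ_ (h zero) (sumℤ-cong (h ∘ suc))

  sumℤ-+ : (g : Fin n → ℕ) → sumℤ P (+_ ∘ g) ≡ + sum g
  sumℤ-+ {zero}  g = refl
  sumℤ-+ {suc n} g = trans (cong (+ g zero +ℤ_) (sumℤ-+ (g ∘ suc))) (sym (ℤP.pos-+ (g zero) _))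

  sumξ-at : (f : Fin n → Zξ P) (e : Z) → sumξ P f e ≡ sumℤ P (λ q → f q e)
  sumξ-at {zero}  f e = refl
  sumξ-at {suc n} f e = cong (f zero e  +ℤ_) (sumξ-at (f ∘ suc) e)

  ξ^-toℕ : ∀ h e → ξ^ P (toℕ h) e ≡ + 𝟙 ⌊ e F.≟ h ⌋
  ξ^-toℕ h e rewrite sym [ toℕ h ]≡modp | []-toℕ h with ⌊ e F.≟ h ⌋
  ... | true  = refl
  ... | false = refl

  *ξ-+ : ∀ (a b : Z → ℕ) e → _*ξ_ P (+_ ∘ a) (+_ ∘ b) e ≡ + sum (λ d → a d * b (e ⊝ d))
  *ξ-+ a b e = trans (sumℤ-cong λ d → trans (cong (λ x → + a d *ℤ + b x) (sym (trans (⊝-def e d) [ _ ]≡modp)))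
                                           (sym (ℤP.pos-* (a d) (b (e ⊝ d)))))
                     (sumℤ-+ (λ d → a d * b (e ⊝ d)))

  *ξ-cong : ∀ {a a′ b b′ : Zξ P} → (∀ d → a d ≡ a′ d) → (∀ d → b d ≡ b′ d) →
            ∀ e → _*ξ_ P a b e ≡ _*ξ_ P a′ b′ e
  *ξ-cong a≗a′ b≗b′ e = sumℤ-cong (λ d → cong₂ _*ℤ_ (a≗a′ d) (b≗b′ (modp P (toℕ e ℕ.+ (P ℕ.∸ toℕ d)))))

  ξ^*ξ^ : ∀ a b e → _*ξ_ P (ξ^ P (toℕ a)) (ξ^ P (toℕ b)) e ≡ + 𝟙 ⌊ e ⊝ a F.≟ b ⌋
  ξ^*ξ^ a b e =
    trans (*ξ-cong (ξ^-toℕ a) (ξ^-toℕ b) e)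
      (trans (*ξ-+ (λ d → 𝟙 ⌊ d F.≟ a ⌋) (λ d → 𝟙 ⌊ d F.≟ b ⌋) e)
        (cong +_ (sum-sift a (λ d → 𝟙 ⌊ e ⊝ d F.≟ b ⌋))))

  Hmat-product : ∀ (h₁ h₂ : Fin P → Fin P → Z) x y e →
    _·M_ P (Hmat P h₁) (Hmat P h₂) x y e ≡ + count (λ q → ⌊ e ⊝ h₁ x q F.≟ h₂ q y ⌋)
  Hmat-product h₁ h₂ x y e =
    trans (sumξ-at (λ q → _*ξ_ P (Hmat P h₁ x q) (Hmat P h₂ q y)) e)
      (trans (sumℤ-cong (λ q → ξ^*ξ^ (h₁ x q) (h₂ q y) e))
        (trans (sumℤ-+ (λ q → 𝟙 ⌊ e ⊝ h₁ x q F.≟ h₂ q y ⌋))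
          (cong +_ (sym (count≡∑𝟙 (λ q → ⌊ e ⊝ h₁ x q F.≟ h₂ q y ⌋))))))

  *ξ-ξ^ : ∀ (C : Z → ℕ) h e → _*ξ_ P (+_ ∘ C) (ξ^ P (toℕ h)) e ≡ + C (e ⊝ h)
  *ξ-ξ^ C h e =
    trans (*ξ-cong {a = +_ ∘ C} (λ _ → refl) (ξ^-toℕ h) e)
      (trans (*ξ-+ C (λ d → 𝟙 ⌊ d F.≟ h ⌋) e)
        (cong +_ (trans (sum-cong-≗ flip-indicator) (sum-sift (e ⊝ h) C))))
    where
    solve : ∀ {d} → e ⊝ d ≡ h → d ≡ e ⊝ h
    solve {d} e⊝d≡h = ⊕≡⇒≡⊝ h e d (sym (⊝≡⇒≡⊕ e⊝d≡h))
    unsolve : ∀ {d} → d ≡ e ⊝ h → e ⊝ d ≡ h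
    unsolve refl = ≡⊕⇒⊝≡ (sym (a⊕[b⊝a]≡b h e))
    flip-indicator : ∀ d → C d * 𝟙 ⌊ e ⊝ d F.≟ h ⌋ ≡ 𝟙 ⌊ d F.≟ e ⊝ h ⌋ * C d
    flip-indicator d = trans (*-comm (C d) _) (cong (λ b → 𝟙 b * C d) (⌊⌋-⇔ (e ⊝ d F.≟ h) (d F.≟ e ⊝ h) solve unsolve))

  *ξ-conjξ : ∀ (C : Z → ℕ) e → _*ξ_ P (+_ ∘ C) (conjξ P (+_ ∘ C)) e ≡ + sum (λ d → C d * C (d ⊝ e))
  *ξ-conjξ C e =
    trans (*ξ-cong {a = +_ ∘ C} {b′ = +_ ∘ C ∘ ⊖_} (λ _ → refl)
                   (λ d → cong (+_ ∘ C) (sym (trans (⊖-def d) [ _ ]≡modp))) e)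
      (trans (*ξ-+ C (C ∘ ⊖_) e) (cong +_ (sum-cong-≗ λ d → cong (λ x → C d * C x) (⊖-⊝ e d))))

  constξ-+ : ∀ e k → constξ P (+ P) e +ℤ + k ≡ + (δ₀ e ℕ.+ k)
  constξ-+ e k rewrite sym [ 0 ]≡modp | []-toℕ 0z with ⌊ e F.≟ 0z ⌋
  ... | true  = sym (ℤP.pos-+ P k)
  ... | false = ℤP.+-identityˡ (+ k)

module Wreath (p′ : ℕ) {N M : ℕ} (X : CoherentConfiguration N M) {m : ℕ}
  (fib : Fin N → Fin m) (fibres : IsFiberLabelling X m fib) where

  open import Data.Fin as F using (zero; suc)
  open import Data.Nat using (zero; suc)
  open import Data.Product using (Σ; ∃; _×_; _,_; proj₁; proj₂)
  open import Data.Sum using (inj₁; inj₂)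
  open import Function using (_∘_; flip)
  open import Function.Bundles using (_⇔_; Equivalence)
  open import Function.Definitions using (Injective)
  open import Relation.Nullary using (¬_; contradiction; yes; no)
  open import Relation.Nullary.Decidable using (⌊_⌋)
  open import Relation.Binary.PropositionalEquality hiding ([_])
  open Counting
  import Data.Fin.Properties as FP
  open ZMod p′
  open Configuration X
  open CoherentConfiguration X

  -- f is an isomorphism from C_p ≀ C_p onto the fibre i; a point f (x , y) lies in block y at position x.
  WreathChart : Fin m → Set
  WreathChart i = Σ (Z × Z → Fin N) λ f →
    (∀ x → fib (f x) ≡ i) × Injective _≡_ _≡_ f ×
    (∀ α → fib α ≡ i → ∃ λ x → f x ≡ α) ×
    (∀ x y x′ y′ → (r (f x) (f y) ≡ r (f x′) (f y′)) ⇔ SameWrRel P x y x′ y′)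

  fib⇒diagonal : ∀ {α β} → fib α ≡ fib β → r α α ≡ r β β
  fib⇒diagonal {α} {β} = Equivalence.to (proj₂ fibres α β)

  r≡⇒target-fib : ∀ {β δ β′ δ′} → r β δ ≡ r β′ δ′ → fib δ ≡ fib δ′
  r≡⇒target-fib e = Equivalence.from (proj₂ fibres _ _) (r≡⇒target-diagonal e)

  r≡⇒source-fib : ∀ {β δ β′ δ′} → r β δ ≡ r β′ δ′ → fib β ≡ fib β′
  r≡⇒source-fib e = Equivalence.from (proj₂ fibres _ _) (r≡⇒source-diagonal e)

  r∈S : ∀ {α β i j} → fib α ≡ i → fib β ≡ j → In-S X fib i j (r α β)
  r∈S fα fβ γ δ e = trans (r≡⇒source-fib e) fα , trans (r≡⇒target-fib e) fβ

  diffₚ≡⊝ : ∀ a b → diffₚ P a b ≡ F.toℕ (b ⊝ a)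
  diffₚ≡⊝ a b = sym (trans (cong F.toℕ (⊝-def b a)) (toℕ-[] _))

  module Coordinates (chart : ∀ i → WreathChart i) where

    emb : Fin m → Z × Z → Fin N
    emb b = proj₁ (chart b)

    emb-fib : ∀ b z → fib (emb b z) ≡ b
    emb-fib b = proj₁ (proj₂ (chart b))

    emb-injective : ∀ b {z z′} → emb b z ≡ emb b z′ → z ≡ z′
    emb-injective b = proj₁ (proj₂ (proj₂ (chart b)))

    emb-rel : ∀ b z₁ z₂ z₁′ z₂′ →
      (r (emb b z₁) (emb b z₂) ≡ r (emb b z₁′) (emb b z₂′)) ⇔ SameWrRel P z₁ z₂ z₁′ z₂′
    emb-rel b = proj₂ (proj₂ (proj₂ (proj₂ (chart b))))

    -- Points outside the fibre b get the junk coordinates (0 , 0).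
    coords : Fin m → Fin N → Z × Z
    coords b α with fib α F.≟ b
    ... | yes αb = proj₁ (proj₁ (proj₂ (proj₂ (proj₂ (chart b)))) α αb)
    ... | no _   = 0z , 0z

    emb-coords : ∀ b α → fib α ≡ b → emb b (coords b α) ≡ α
    emb-coords b α αb with fib α F.≟ b
    ... | yes αb′ = proj₂ (proj₁ (proj₂ (proj₂ (proj₂ (chart b)))) α αb′)
    ... | no ¬αb  = contradiction αb ¬αb

    coords-emb : ∀ b z → coords b (emb b z) ≡ z
    coords-emb b z = emb-injective b (emb-coords b (emb b z) (emb-fib b z))

    xc yc : Fin m → Fin N → Z
    xc b = proj₁ ∘ coords b
    yc b = proj₂ ∘ coords b

    xc-emb : ∀ b x y → xc b (emb b (x , y)) ≡ x
    xc-emb b x y = cong proj₁ (coords-emb b (x , y))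

    yc-emb : ∀ b x y → yc b (emb b (x , y)) ≡ y
    yc-emb b x y = cong proj₂ (coords-emb b (x , y))

    same-block-rel : ∀ b {x y x′ u v u′} → x′ ⊝ x ≡ u′ ⊝ u →
      r (emb b (x , y)) (emb b (x′ , y)) ≡ r (emb b (u , v)) (emb b (u′ , v))
    same-block-rel b {x} {_} {x′} {u} {_} {u′} e = Equivalence.from (emb-rel b _ _ _ _)
      (inj₁ (refl , refl , trans (diffₚ≡⊝ x x′) (trans (cong F.toℕ e) (sym (diffₚ≡⊝ u u′)))))

    cross-block-rel : ∀ b {x y x′ y′ u v u′ v′} → ¬ y ≡ y′ → ¬ v ≡ v′ → y′ ⊝ y ≡ v′ ⊝ v →
      r (emb b (x , y)) (emb b (x′ , y′)) ≡ r (emb b (u , v)) (emb b (u′ , v′))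
    cross-block-rel b {_} {y} {_} {y′} {_} {v} {_} {v′} y≢y′ v≢v′ e = Equivalence.from (emb-rel b _ _ _ _)
      (inj₂ (y≢y′ , v≢v′ , trans (diffₚ≡⊝ y y′) (trans (cong F.toℕ e) (sym (diffₚ≡⊝ v v′)))))

    same-block-rel⁻¹ : ∀ b {x y x′ y′ u v u′} →
      r (emb b (x , y)) (emb b (x′ , y′)) ≡ r (emb b (u , v)) (emb b (u′ , v)) → y ≡ y′ × x′ ⊝ x ≡ u′ ⊝ u
    same-block-rel⁻¹ b e with Equivalence.to (emb-rel b _ _ _ _) e
    ... | inj₁ (y≡y′ , _ , d) = y≡y′ , FP.toℕ-injective (trans (sym (diffₚ≡⊝ _ _)) (trans d (diffₚ≡⊝ _ _)))
    ... | inj₂ (_ , v≢v , _) = contradiction refl v≢v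

    shift : Fin m → Z → Fin N → Fin N
    shift b d α = emb b (xc b α ⊕ d , yc b α)

    shift-fib : ∀ b d α → fib (shift b d α) ≡ b
    shift-fib b d α = emb-fib b _

    xc-shift : ∀ b d α → xc b (shift b d α) ≡ xc b α ⊕ d
    xc-shift b d α = xc-emb b _ _

    yc-shift : ∀ b d α → yc b (shift b d α) ≡ yc b α
    yc-shift b d α = yc-emb b _ _

    shift-shift : ∀ b d e α → shift b d (shift b e α) ≡ shift b (e ⊕ d) α
    shift-shift b d e α =
      cong (emb b) (cong₂ _,_ (trans (cong (_⊕ d) (xc-shift b e α)) (⊕-assoc _ e d)) (yc-shift b e α))

    shift-identity : ∀ b α → fib α ≡ b → shift b 0z α ≡ α
    shift-identity b α αb = trans (cong (λ x → emb b (x , yc b α)) (⊕-identityʳ _)) (emb-coords b α αb)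

    shift-fixed⇒0 : ∀ b d α → shift b d α ≡ α → d ≡ 0z
    shift-fixed⇒0 b d α e = ⊕-cancelʳ d 0z (xc b α)
      (trans (⊕-comm d _) (trans (sym (xc-shift b d α)) (trans (cong (xc b) e) (sym (⊕-identityˡ _)))))

    r-shift-invariant : ∀ b d γ γ₀ → fib γ ≡ b → fib γ₀ ≡ b → r γ (shift b d γ) ≡ r γ₀ (shift b d γ₀)
    r-shift-invariant b d γ γ₀ γb γ₀b =
      trans (cong (λ z → r z (shift b d γ)) (sym (emb-coords b γ γb)))
        (trans (same-block-rel b (trans (x⊕d⊝x (xc b γ)) (sym (x⊕d⊝x (xc b γ₀)))))
          (cong (λ z → r z (shift b d γ₀)) (emb-coords b γ₀ γ₀b)))
      where
      x⊕d⊝x : ∀ x → x ⊕ d ⊝ x ≡ d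
      x⊕d⊝x x = trans (cong (_⊝ x) (⊕-comm x d)) (a⊕b⊝b≡a d x)

    shift-unique : ∀ b d γ₀ γ δ → fib γ₀ ≡ b → fib γ ≡ b → r γ δ ≡ r γ₀ (shift b d γ₀) → δ ≡ shift b d γ
    shift-unique b d γ₀ γ δ γ₀b γb e =
      let δb : fib δ ≡ b
          δb = trans (r≡⇒target-fib e) (shift-fib b d γ₀)
          y≡ , dx≡ = same-block-rel⁻¹ b
            (trans (cong₂ r (emb-coords b γ γb) (emb-coords b δ δb))
                   (trans e (cong (λ z → r z (shift b d γ₀)) (sym (emb-coords b γ₀ γ₀b)))))
          xδ : xc b δ ≡ xc b γ ⊕ d
          xδ = trans (⊝≡⇒≡⊕ (trans dx≡ (trans (cong (_⊝ xc b γ₀) (⊕-comm _ d)) (a⊕b⊝b≡a d _)))) (⊕-comm d _)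
      in trans (sym (emb-coords b δ δb)) (cong (emb b) (cong₂ _,_ xδ (sym y≡)))

    same-block⇒shift : ∀ b α β → fib α ≡ b → fib β ≡ b → yc b α ≡ yc b β → β ≡ shift b (xc b β ⊝ xc b α) α
    same-block⇒shift b α β αb βb y≡ =
      trans (sym (emb-coords b β βb)) (cong (emb b) (cong₂ _,_ (sym (a⊕[b⊝a]≡b (xc b α) (xc b β))) (sym y≡)))

    -- A relation from α into another block contains all p ≥ 2 points of that block.
    thin⇒same-block : ∀ b τ → InOθ X fib b τ → ∀ α β → r α β ≡ τ → yc b α ≡ yc b β
    thin⇒same-block b τ (τ∈S , thin) α β αβ with yc b α F.≟ yc b β
    ... | yes y≡ = y≡
    ... | no y≢  =
      let αb , βb = τ∈S α β αβ
          to-block : ∀ x → r α (emb b (x , yc b β)) ≡ τ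
          to-block x = trans (cong (λ z → r z (emb b (x , yc b β))) (sym (emb-coords b α αb)))
                         (trans (cross-block-rel b y≢ y≢ refl) (trans (cong₂ r (emb-coords b α αb) (emb-coords b β βb)) αβ))
      in contradiction (cong proj₁ (emb-injective b (thin-successor-unique (thin α αb) (to-block 0z) (to-block 1z)))) λ ()

    same-block⇒thin : ∀ b α β → fib α ≡ b → fib β ≡ b → yc b α ≡ yc b β → InOθ X fib b (r α β)
    same-block⇒thin b α β αb βb y≡ = r∈S αb βb , thin
      where
      d : Z
      d = xc b β ⊝ xc b α
      β≡ : β ≡ shift b d α
      β≡ = same-block⇒shift b α β αb βb y≡
      thin : ∀ α′ → fib α′ ≡ b → valency-at X α′ (r α β) ≡ 1
      thin α′ α′b = count≡1 _ (shift b d α′)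
        (λ δ e → shift-unique b d α α′ δ αb α′b (trans (⌊⌋≡true⁻¹ (r α′ δ F.≟ r α β) e) (cong (r α) β≡)))
        (⌊⌋≡true (r α′ (shift b d α′) F.≟ r α β) (trans (r-shift-invariant b d α′ α α′b αb) (cong (r α) (sym β≡))))

    r-shiftʳ : ∀ c d {β δ β′ δ′} → fib δ ≡ c → fib δ′ ≡ c →
               r β δ ≡ r β′ δ′ → r β (shift c d δ) ≡ r β′ (shift c d δ′)
    r-shiftʳ c d δc δ′c e = r-extendʳ e refl (λ x → shift-unique c d _ _ x δc δ′c)

    r-shiftˡ : ∀ b d {β δ β′ δ′} → fib β ≡ b → fib β′ ≡ b →
               r β δ ≡ r β′ δ′ → r (shift b d β) δ ≡ r (shift b d β′) δ′
    r-shiftˡ b d βb β′b e = r-extendˡ e refl (λ x → shift-unique b d _ _ x βb β′b)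

    r-shift² : ∀ b c d d′ {β δ β′ δ′} → fib β ≡ b → fib β′ ≡ b → fib δ ≡ c → fib δ′ ≡ c →
               r β δ ≡ r β′ δ′ →
               r (shift b d β) (shift c d′ δ) ≡ r (shift b d β′) (shift c d′ δ′)
    r-shift² b c d d′ βb β′b δc δ′c e = r-shiftʳ c d′ δc δ′c (r-shiftˡ b d βb β′b e)

    r-other-block-constant : ∀ b β β′ β″ → fib β ≡ b → fib β′ ≡ b → fib β″ ≡ b →
      ¬ yc b β ≡ yc b β′ → yc b β″ ≡ yc b β′ → r β β″ ≡ r β β′
    r-other-block-constant b β β′ β″ βb β′b β″b y≢ y≡ =
      trans (cong₂ r (sym (emb-coords b β βb)) (sym (emb-coords b β″ β″b)))
        (trans (cross-block-rel b (y≢ ∘ flip trans y≡) y≢ (cong (_⊝ yc b β) y≡))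
          (cong₂ r (emb-coords b β βb) (emb-coords b β′ β′b)))

    count-shift≡1 : ∀ b γ γ′ → fib γ ≡ b → fib γ′ ≡ b → yc b γ ≡ yc b γ′ →
                    count (λ x → ⌊ γ F.≟ shift b x γ′ ⌋) ≡ 1
    count-shift≡1 b γ γ′ γb γ′b y≡ = count≡1 _ (xc b γ ⊝ xc b γ′)
      (λ x e → ⊕≡⇒≡⊝ (xc b γ′) (xc b γ) x (sym (trans (cong (xc b) (⌊⌋≡true⁻¹ (γ F.≟ shift b x γ′) e)) (xc-shift b x γ′))))
      (⌊⌋≡true (γ F.≟ _) (same-block⇒shift b γ′ γ γ′b γb (sym y≡)))

    module Translation (t : Fin m → Fin M) (t-thin : ∀ b → InOθ X fib b (t b)) where

      private
        t-pair : ∀ b → ∃ λ α → ∃ λ β → r α β ≡ t b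
        t-pair b = nonempty (t b)

        α₀ β₀ : Fin m → Fin N
        α₀ b = proj₁ (t-pair b)
        β₀ b = proj₁ (proj₂ (t-pair b))

        α₀β₀ : ∀ b → r (α₀ b) (β₀ b) ≡ t b
        α₀β₀ b = proj₂ (proj₂ (t-pair b))

        α₀-fib : ∀ b → fib (α₀ b) ≡ b
        α₀-fib b = proj₁ (proj₁ (t-thin b) _ _ (α₀β₀ b))

        β₀-fib : ∀ b → fib (β₀ b) ≡ b
        β₀-fib b = proj₂ (proj₁ (t-thin b) _ _ (α₀β₀ b))

      -- t b moves every point of the fibre b by κ b inside its block.
      κ : Fin m → Z
      κ b = xc b (β₀ b) ⊝ xc b (α₀ b)

      step : Fin m → Fin N → Fin N
      step b = shift b (κ b)

      step-rel : ∀ b α → fib α ≡ b → r α (step b α) ≡ t b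
      step-rel b α αb = trans (r-shift-invariant b (κ b) α (α₀ b) αb (α₀-fib b))
        (trans (cong (r (α₀ b)) (sym β₀≡)) (α₀β₀ b))
        where
        β₀≡ : β₀ b ≡ step b (α₀ b)
        β₀≡ = same-block⇒shift b _ _ (α₀-fib b) (β₀-fib b) (thin⇒same-block b (t b) (t-thin b) _ _ (α₀β₀ b))

      step-unique : ∀ b α γ → fib α ≡ b → r α γ ≡ t b → γ ≡ step b α
      step-unique b α γ αb αγ =
        shift-unique b (κ b) (α₀ b) α γ (α₀-fib b) αb (trans αγ (sym (step-rel b (α₀ b) (α₀-fib b))))

      step-shift : ∀ b e δ → step b (shift b e δ) ≡ shift b e (step b δ)
      step-shift b e δ = trans (shift-shift b (κ b) e δ)
        (trans (cong (λ z → shift b z δ) (⊕-comm e (κ b))) (sym (shift-shift b e (κ b) δ)))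

      Pow⇒shift : ∀ b n β γ → fib β ≡ b → Pow X (t b) n β γ → γ ≡ shift b ([ n ] ⊗ κ b) β
      Pow⇒shift b zero    β γ βb refl = sym (trans (cong (λ d → shift b d β) ([0]⊗ (κ b))) (shift-identity b β βb))
      Pow⇒shift b (suc n) β γ βb (δ , βδ , pow) =
        let δ≡ = step-unique b β δ βb βδ
        in begin
          γ                                     ≡⟨ Pow⇒shift b n δ γ (trans (cong fib δ≡) (shift-fib b _ β)) pow ⟩
          shift b ([ n ] ⊗ κ b) δ               ≡⟨ cong (shift b ([ n ] ⊗ κ b)) δ≡ ⟩
          shift b ([ n ] ⊗ κ b) (step b β)      ≡⟨ shift-shift b _ _ β ⟩
          shift b (κ b ⊕ [ n ] ⊗ κ b) β         ≡⟨ cong (λ d → shift b d β) (trans (⊕-comm _ _) (sym ([suc]⊗ n (κ b)))) ⟩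
          shift b ([ suc n ] ⊗ κ b) β           ∎
        where open ≡-Reasoning

module Setting (p′ : ℕ) (prime : Prime (suc (suc p′))) {N M : ℕ} (m : ℕ) (X : CoherentConfiguration N M)
  (fib : Fin N → Fin (suc m)) (fibres : IsFiberLabelling X (suc m) fib)
  (chart : ∀ i → Wreath.WreathChart p′ X fib fibres i)
  (valency : ∀ i j → ¬ i ≡ j → ∀ s → In-S X fib i j s → ∀ α → fib α ≡ i → valency-at X α s ≡ suc (suc p′))
  (non-regular : ∀ s → (∃ λ i → In-S X fib i i s) ⊎ ¬ Regular X s)
  (a : Fin (suc m) → Fin N) (a-fib : ∀ i → fib (a i) ≡ i)
  (t : Fin (suc m) → Fin M) (t-thin : ∀ i → InOθ X fib i (t i))
  (t₀≢1 : ¬ t zero ≡ CoherentConfiguration.r X (a zero) (a zero))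
  (t-compatible : ∀ i → ¬ i ≡ zero → ∀ γ δ → CoherentConfiguration.r X (a zero) γ ≡ t zero →
     CoherentConfiguration.r X (a i) δ ≡ t i → CoherentConfiguration.r X γ δ ≡ CoherentConfiguration.r X (a zero) (a i))
  (rep : Fin (suc m) → Fin (suc (suc p′)) → Fin N) (rep-fib : ∀ i k → fib (rep i k) ≡ i)
  (rep-classes : ∀ i β → fib β ≡ i → ∃ λ k → InOθ X fib i (CoherentConfiguration.r X (rep i k) β) ×
     (∀ k′ → InOθ X fib i (CoherentConfiguration.r X (rep i k′) β) → k′ ≡ k))
  where

  open import Data.Nat using (zero; _+_; _*_; _<_; z≤n; s≤s)
  open import Data.Nat.Properties using (*-identityʳ; *-cancelˡ-≡; +-cancelˡ-≡; +-identityʳ)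
  open import Data.Fin as F using (zero; suc; toℕ)
  open import Data.Bool using (Bool; true; false; _∧_; not)
  open import Data.Product using (_,_; proj₁; proj₂)
  open import Data.Sum using (inj₁; inj₂)
  open import Function using (_∘_)
  open import Function.Bundles using (mk⇔)
  open import Relation.Nullary using (yes; no; _×-dec_; contradiction)
  open import Data.Empty using (⊥; ⊥-elim)
  open import Relation.Nullary.Decidable using (⌊_⌋)
  open import Relation.Binary.PropositionalEquality hiding ([_])
  open Counting
  open ZMod p′
  open Autocorrelation p′
  open Cyclotomic p′
  open import Data.Integer using (+_)
  import Data.Integer as ℤ using (_+_)
  import Data.Integer.Properties as ℤP
  open Configuration X
  open CoherentConfiguration X
  open Wreath p′ X fib fibres
  open Coordinates chart
  open Translation t t-thin

  I : Set
  I = Fin (suc m)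

  module CrossRelation (i j : I) (i≢j : ¬ i ≡ j) (s : Fin M) (s∈S : In-S X fib i j s) where

    source-fib : ∀ {α β} → r α β ≡ s → fib α ≡ i
    source-fib e = proj₁ (s∈S _ _ e)

    target-fib : ∀ {α β} → r α β ≡ s → fib β ≡ j
    target-fib e = proj₂ (s∈S _ _ e)

    -- If α s meets a block of Ω_j twice then s is closed under all shifts of that block;
    -- since α s has exactly p points it is then a single block, which makes s regular.
    module TwoInOneBlock (α γ γ′ : Fin N) (αγ : r α γ ≡ s) (αγ′ : r α γ′ ≡ s)
      (y≡ : yc j γ ≡ yc j γ′) (γ≢γ′ : ¬ γ ≡ γ′) where

      d : Z
      d = xc j γ′ ⊝ xc j γ

      γ′≡ : γ′ ≡ shift j d γ
      γ′≡ = same-block⇒shift j γ γ′ (target-fib αγ) (target-fib αγ′) y≡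

      d≢0 : ¬ d ≡ 0z
      d≢0 d≡0 = γ≢γ′ (sym (trans γ′≡ (trans (cong (λ x → shift j x γ) d≡0) (shift-identity j γ (target-fib αγ)))))

      ClosedUnder : Z → Set
      ClosedUnder e = ∀ α₁ β₁ → r α₁ β₁ ≡ s → r α₁ (shift j e β₁) ≡ s

      closed : ∀ e → ClosedUnder e
      closed = ⊕-induction prime ClosedUnder d d≢0 closed-0 closed-step
        where
        closed-0 : ClosedUnder 0z
        closed-0 α₁ β₁ e = trans (cong (r α₁) (shift-identity j β₁ (target-fib e))) e
        closed-step : ∀ x → ClosedUnder x → ClosedUnder (x ⊕ d)
        closed-step x cx α₁ β₁ e =
          trans (cong (r α₁) (sym (shift-shift j d x β₁)))
            (trans (sym (r-extendʳ (trans αγ (sym (cx α₁ β₁ e))) refl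
                      (λ δ eδ → shift-unique j d γ _ δ (target-fib αγ) (shift-fib j x β₁) (trans eδ (cong (r γ) γ′≡)))))
                   αγ′)

      closed-in-block : ∀ α₁ β₁ β₂ → r α₁ β₁ ≡ s → fib β₂ ≡ j → yc j β₂ ≡ yc j β₁ → r α₁ β₂ ≡ s
      closed-in-block α₁ β₁ β₂ e β₂j y₂ =
        trans (cong (r α₁) (same-block⇒shift j β₁ β₂ (target-fib e) β₂j (sym y₂))) (closed _ α₁ β₁ e)

      within-block : ∀ α₁ β₁ γ₁ → r α₁ β₁ ≡ s → r α₁ γ₁ ≡ s → yc j γ₁ ≡ yc j β₁
      within-block α₁ β₁ γ₁ e₁ eγ₁ = ⌊⌋≡true⁻¹ (yc j γ₁ F.≟ y) (proj₂ (∧-true⁻¹ γ₁-in-block))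
        where
        y : Z
        y = yc j β₁
        InS : Fin N → Bool
        InS γ = ⌊ r α₁ γ F.≟ s ⌋
        InBlock : Fin N → Bool
        InBlock γ = ⌊ fib γ F.≟ j ⌋ ∧ ⌊ yc j γ F.≟ y ⌋
        count-block : count (λ γ → InBlock γ ∧ InS γ) ≡ P
        count-block =
          trans (count-bijection InBlock (λ x → emb j (x , y)) (xc j)
                   (λ γ bl → let γj , γy = ∧-true⁻¹ bl in
                      trans (cong (λ z → emb j (xc j γ , z)) (sym (⌊⌋≡true⁻¹ (yc j γ F.≟ y) γy)))
                            (emb-coords j γ (⌊⌋≡true⁻¹ (fib γ F.≟ j) γj)))
                   (λ x → ∧-true (⌊⌋≡true (fib _ F.≟ j) (emb-fib j _)) (⌊⌋≡true (yc j _ F.≟ y) (yc-emb j x y)))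
                   (λ x → xc-emb j x y) InS)
            (trans (count-cong (λ x → ⌊⌋≡true (r α₁ _ F.≟ s) (closed-in-block α₁ β₁ _ e₁ (emb-fib j _) (yc-emb j x y))))
                   (count-true P))
        outside-block : count (λ γ → InS γ ∧ not (InBlock γ)) ≡ 0
        outside-block = +-cancelˡ-≡ P _ 0 (begin
          P + outside                              ≡⟨ cong (_+ outside) count-block ⟨
          count (λ γ → InBlock γ ∧ InS γ) + outside ≡⟨ count-split InS InBlock ⟨
          count InS                                ≡⟨ valency i j i≢j s s∈S α₁ (source-fib e₁) ⟩
          P                                        ≡⟨ +-identityʳ P ⟨
          P + 0                                    ∎)
          where
          open ≡-Reasoning
          outside : ℕ
          outside = count (λ γ → InS γ ∧ not (InBlock γ))
        γ₁-in-block : InBlock γ₁ ≡ true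
        γ₁-in-block with InBlock γ₁ in eq
        ... | true  = refl
        ... | false = contradiction (trans (sym (cong (λ b → InS γ₁ ∧ not b) eq))
                                      (count≡0⇒false _ outside-block γ₁))
                                    (subst (λ b → ¬ b ∧ true ≡ false) (sym (⌊⌋≡true (r α₁ γ₁ F.≟ s) eγ₁)) λ ())

      regular : Regular X s
      regular u = mk⇔ to from
        where
        to : InSSstarS X s u → u ≡ s
        to (v , s-s*>0 , v-s>0) =
          let α₂ , γ₂ , α₂γ₂    = nonempty u
              δ , α₂δ , δγ₂     = c>0⇒path {α₂} {γ₂} (subst (λ z → 0 < c v s z) (sym α₂γ₂) v-s>0)
              β , α₂β , βδ      = c>0⇒path {α₂} {δ} (subst (λ z → 0 < c s (star s) z) (sym α₂δ) s-s*>0)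
              δβ : r δ β ≡ s
              δβ = trans (r-star βδ) (star-involutive s)
          in trans (sym α₂γ₂) (closed-in-block α₂ β γ₂ α₂β (target-fib δγ₂) (within-block δ β γ₂ δβ δγ₂))
        from : u ≡ s → InSSstarS X s u
        from refl =
          let α₂ , β , α₂β = nonempty s
          in r α₂ α₂ , path⇒c>0 α₂β (r-star α₂β) ,
             subst (λ z → 0 < c (r α₂ α₂) s z) α₂β (path⇒c>0 {α₂} {β} refl α₂β)

    not-regular : ¬ Regular X s
    not-regular with non-regular s
    ... | inj₂ ¬reg = ¬reg
    ... | inj₁ (k , s∈Sₖ) =
      let α , β , αβ = nonempty s
          αk , βk = s∈Sₖ α β αβ
      in contradiction (trans (sym (source-fib αβ)) (trans αk (trans (sym βk) (target-fib αβ)))) i≢j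

    meets-block-once : ∀ α γ γ′ → r α γ ≡ s → r α γ′ ≡ s → yc j γ ≡ yc j γ′ → γ ≡ γ′
    meets-block-once α γ γ′ αγ αγ′ y≡ with γ F.≟ γ′
    ... | yes γ≡γ′ = γ≡γ′
    ... | no  γ≢γ′ = contradiction (TwoInOneBlock.regular α γ γ′ αγ αγ′ y≡ γ≢γ′) not-regular

  meets-block-once : ∀ α β → ¬ fib α ≡ fib β → ∀ γ γ′ → r α γ ≡ r α β → r α γ′ ≡ r α β →
    yc (fib β) γ ≡ yc (fib β) γ′ → γ ≡ γ′
  meets-block-once α β α≁β = CrossRelation.meets-block-once (fib α) (fib β) α≁β (r α β) (r∈S refl refl) α

  yr : I → Fin P → Z
  yr b q = yc b (rep b q)

  yr-injective : ∀ b q q′ → yr b q ≡ yr b q′ → q ≡ q′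
  yr-injective b q q′ e =
    let _ , _ , unique = rep-classes b (rep b q′) (rep-fib b q′)
    in trans (unique q (same-block⇒thin b _ _ (rep-fib b q) (rep-fib b q′) e))
             (sym (unique q′ (same-block⇒thin b _ _ (rep-fib b q′) (rep-fib b q′) refl)))

  blockOf : I → Z → Fin P
  blockOf b y = proj₁ (rep-classes b (emb b (0z , y)) (emb-fib b _))

  yr-blockOf : ∀ b y → yr b (blockOf b y) ≡ y
  yr-blockOf b y =
    let _ , thin , _ = rep-classes b (emb b (0z , y)) (emb-fib b _)
    in trans (thin⇒same-block b _ thin _ _ refl) (yc-emb b 0z y)

  blockOf-yr : ∀ b q → blockOf b (yr b q) ≡ q
  blockOf-yr b q = yr-injective b _ _ (yr-blockOf b (yr b q))

  block : I → Fin N → Fin P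
  block b β = blockOf b (yc b β)

  block≡⇒yc≡ : ∀ b β β′ → block b β ≡ block b β′ → yc b β ≡ yc b β′
  block≡⇒yc≡ b β β′ e = trans (sym (yr-blockOf b _)) (trans (cong (yr b) e) (yr-blockOf b _))

  κ₀≢0 : ¬ κ zero ≡ 0z
  κ₀≢0 κ₀≡0 = t₀≢1 (trans (sym (step-rel zero (a zero) (a-fib zero)))
    (cong (r (a zero)) (trans (cong (λ d → shift zero d (a zero)) κ₀≡0) (shift-identity zero (a zero) (a-fib zero)))))

  -- If κ b = 0, t-compatible puts both a 0 and a 0 t₀ into (a b) r (a b) (a 0), which meets
  -- each block of Ω₀ only once.
  κ≢0 : ∀ b → ¬ κ b ≡ 0z
  κ≢0 b κb≡0 with b F.≟ zero
  ... | yes refl = κ₀≢0 κb≡0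
  ... | no  b≢0 =
    let a₀ = a zero
        fixed : step b (a b) ≡ a b
        fixed = trans (cong (λ d → shift b d (a b)) κb≡0) (shift-identity b (a b) (a-fib b))
        compatible : r (step zero a₀) (a b) ≡ r a₀ (a b)
        compatible = t-compatible b b≢0 _ (a b) (step-rel zero a₀ (a-fib zero))
                       (trans (cong (r (a b)) (sym fixed)) (step-rel b (a b) (a-fib b)))
        a₀≡ = meets-block-once (a b) a₀ (λ e → b≢0 (trans (sym (a-fib b)) (trans e (a-fib zero))))
                a₀ (step zero a₀) refl (r-flip compatible)
                (subst (λ z → yc z a₀ ≡ yc z (step zero a₀)) (sym (a-fib zero)) (sym (yc-shift zero _ a₀)))
    in κ₀≢0 (shift-fixed⇒0 zero (κ zero) a₀ (sym a₀≡))

  point : I → Fin P → Z → Fin N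
  point b q e = shift b (e ⊗ κ b) (rep b q)

  point-fib : ∀ b q e → fib (point b q e) ≡ b
  point-fib b q e = shift-fib b _ _

  yc-point : ∀ b q e → yc b (point b q e) ≡ yr b q
  yc-point b q e = yc-shift b _ _

  block-point : ∀ b q e → block b (point b q e) ≡ q
  block-point b q e = trans (cong (blockOf b) (yc-point b q e)) (blockOf-yr b q)

  point-injective : ∀ b q e e′ → point b q e ≡ point b q e′ → e ≡ e′
  point-injective b q e e′ eq = ⊗-cancelʳ prime e e′ (κ b) (κ≢0 b)
    (⊕-cancelʳ _ _ (xc b (rep b q))
      (trans (⊕-comm _ _) (trans (sym (xc-shift b _ _)) (trans (cong (xc b) eq) (trans (xc-shift b _ _) (⊕-comm _ _))))))

  offset : I → Fin N → Z
  offset b β = proj₁ (⊗-divide prime (κ b) (κ≢0 b) (xc b β ⊝ xc b (rep b (block b β))))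

  point-offset : ∀ b β → fib β ≡ b → point b (block b β) (offset b β) ≡ β
  point-offset b β βb =
    trans (cong (λ d → shift b d (rep b q)) (proj₂ (⊗-divide prime (κ b) (κ≢0 b) (xc b β ⊝ xc b (rep b q)))))
          (sym (same-block⇒shift b (rep b q) β (rep-fib b q) βb (yr-blockOf b (yc b β))))
    where
    q : Fin P
    q = block b β

  shift-point : ∀ b q e z → shift b (z ⊗ κ b) (point b q e) ≡ point b q (e ⊕ z)
  shift-point b q e z = trans (shift-shift b _ _ _) (cong (λ d → shift b d (rep b q)) (sym (⊗-distribʳ e z (κ b))))

  in-block⇒point : ∀ b β q → fib β ≡ b → block b β ≡ q → β ≡ point b q (offset b β)
  in-block⇒point b β q βb βq = trans (sym (point-offset b β βb)) (cong (λ z → point b z (offset b β)) βq)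

  module Neighbours (i j : I) (i≢j : ¬ i ≡ j) (u : Fin M) (u∈S : In-S X fib i j u) where

    open CrossRelation i j i≢j u u∈S using (source-fib; target-fib) renaming (meets-block-once to u-meets-block-once)

    -- nbr α q is the unique γ ∈ α u in block q of Ω_j; it exists because α u has p points,
    -- one in each of the p blocks.
    private
      IsNbr : Fin N → Fin P → Fin N → Set
      IsNbr α q γ = r α γ ≡ u × block j γ ≡ q

    nbr : Fin N → Fin P → Fin N
    nbr α q = choose (λ γ → (r α γ F.≟ u) ×-dec (block j γ F.≟ q)) α

    private
      nbr-spec : ∀ α q → fib α ≡ i → IsNbr α q (nbr α q)
      nbr-spec α q αi = choose-spec {P = IsNbr α q} (λ γ → (r α γ F.≟ u) ×-dec (block j γ F.≟ q)) α
        (let γ , αγ , γq = injective⇒onto (λ γ → ⌊ r α γ F.≟ u ⌋) (block j) (valency i j i≢j u u∈S α αi)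
                             (λ x y αx αy → u-meets-block-once α x y (⌊⌋≡true⁻¹ (r α x F.≟ u) αx)
                                              (⌊⌋≡true⁻¹ (r α y F.≟ u) αy) ∘ block≡⇒yc≡ j x y) q
         in γ , ⌊⌋≡true⁻¹ (r α γ F.≟ u) αγ , γq)

    nbr-rel : ∀ α q → fib α ≡ i → r α (nbr α q) ≡ u
    nbr-rel α q αi = proj₁ (nbr-spec α q αi)

    block-nbr : ∀ α q → fib α ≡ i → block j (nbr α q) ≡ q
    block-nbr α q αi = proj₂ (nbr-spec α q αi)

    nbr-fib : ∀ α q → fib α ≡ i → fib (nbr α q) ≡ j
    nbr-fib α q αi = target-fib (nbr-rel α q αi)

    rel⇒nbr : ∀ α q γ → block j γ ≡ q → r α γ ≡ u → γ ≡ nbr α q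
    rel⇒nbr α q γ γq αγ =
      trans (u-meets-block-once α γ _ αγ (nbr-rel α _ αi) (block≡⇒yc≡ j _ _ (sym (block-nbr α _ αi))))
            (cong (nbr α) γq)
      where
      αi : fib α ≡ i
      αi = source-fib αγ

    count-nbr : ∀ α → fib α ≡ i → ∀ (Q : Fin N → Bool) →
                count (λ γ → ⌊ r α γ F.≟ u ⌋ ∧ Q γ) ≡ count (Q ∘ nbr α)
    count-nbr α αi Q = count-bijection (λ γ → ⌊ r α γ F.≟ u ⌋) (nbr α) (block j)
      (λ γ αγ → sym (rel⇒nbr α _ γ refl (⌊⌋≡true⁻¹ (r α γ F.≟ u) αγ)))
      (λ q → ⌊⌋≡true (r α _ F.≟ u) (nbr-rel α q αi))
      (λ q → block-nbr α q αi) Q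

    nbr≡point : ∀ α q → fib α ≡ i → nbr α q ≡ point j q (offset j (nbr α q))
    nbr≡point α q αi = in-block⇒point j _ q (nbr-fib α q αi) (block-nbr α q αi)

    Twist : Z → Set
    Twist d = ∀ β γ → r β γ ≡ u → r (step i β) (shift j d γ) ≡ u

    twist-exists : ∃ Twist
    twist-exists =
      let β₀ , γ₀ , β₀γ₀ = nonempty u
          β₀i , γ₀j = u∈S β₀ γ₀ β₀γ₀
          β₁ = step i β₀
          β₁i = shift-fib i (κ i) β₀
          γ₁ = nbr β₁ (block j γ₀)
          γ₁≡ : γ₁ ≡ shift j (xc j γ₁ ⊝ xc j γ₀) γ₀
          γ₁≡ = same-block⇒shift j γ₀ γ₁ γ₀j (nbr-fib _ _ β₁i) (block≡⇒yc≡ j _ _ (sym (block-nbr _ _ β₁i)))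
      in xc j γ₁ ⊝ xc j γ₀ , λ β γ βγ →
           let βi , γj = u∈S β γ βγ
           in trans (r-shift² i j (κ i) _ βi β₀i γj γ₀j (trans βγ (sym β₀γ₀)))
                    (trans (cong (r β₁) (sym γ₁≡)) (nbr-rel _ _ β₁i))

    module Twisted (d : Z) (twist : Twist d) where

      nbr-step : ∀ β q → fib β ≡ i → nbr (step i β) q ≡ shift j d (nbr β q)
      nbr-step β q βi = sym (rel⇒nbr (step i β) q _
        (trans (cong (blockOf j) (yc-shift j d _)) (block-nbr β q βi)) (twist β _ (nbr-rel β q βi)))

      twist⁻¹ : ∀ β γ → fib β ≡ i → fib γ ≡ j → r (step i β) (shift j d γ) ≡ u → r β γ ≡ u
      twist⁻¹ β γ βi γj e = trans (cong (r β) γ≡nbr) (nbr-rel β q βi)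
        where
        q : Fin P
        q = block j γ
        γ′ : Fin N
        γ′ = nbr β q
        shifted≡ : shift j d γ ≡ shift j d γ′
        shifted≡ = u-meets-block-once (step i β) _ _ e (twist β γ′ (nbr-rel β q βi))
          (trans (yc-shift j d γ) (trans (block≡⇒yc≡ j _ _ (sym (block-nbr β q βi))) (sym (yc-shift j d γ′))))
        unshift : ∀ δ → fib δ ≡ j → shift j (⊖ d) (shift j d δ) ≡ δ
        unshift δ δj = trans (shift-shift j (⊖ d) d δ) (trans (cong (λ z → shift j z δ) (⊕-inverseʳ d)) (shift-identity j δ δj))
        γ≡nbr : γ ≡ γ′
        γ≡nbr = trans (sym (unshift γ γj)) (trans (cong (shift j (⊖ d)) shifted≡) (unshift γ′ (nbr-fib β q βi)))

      -- With d = 0 both β and β t_i would lie in γ r γ β, which meets each block of Ω_i once.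
      twist≢0 : ¬ d ≡ 0z
      twist≢0 d≡0 =
        let β , γ , βγ = nonempty u
            βi , γj = u∈S β γ βγ
            stepβγ : r (step i β) γ ≡ u
            stepβγ = trans (cong (r (step i β)) (sym (trans (cong (λ z → shift j z γ) d≡0) (shift-identity j γ γj))))
                           (twist β γ βγ)
            β≡ = meets-block-once γ β (λ e → i≢j (trans (sym βi) (trans (sym e) γj))) β (step i β) refl
                   (trans (r-star stepβγ) (sym (r-star βγ)))
                   (subst (λ z → yc z β ≡ yc z (step i β)) (sym βi) (sym (yc-shift i _ β)))
        in κ≢0 i (shift-fixed⇒0 i (κ i) β (sym β≡))

      nbr-steps : ∀ n β → fib β ≡ i → ∀ q → nbr (shift i ([ n ] ⊗ κ i) β) q ≡ shift j ([ n ] ⊗ d) (nbr β q)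
      nbr-steps zero β βi q =
        trans (cong (λ z → nbr (shift i z β) q) ([0]⊗ (κ i)))
          (trans (cong (λ z → nbr z q) (shift-identity i β βi))
            (sym (trans (cong (λ z → shift j z (nbr β q)) ([0]⊗ d)) (shift-identity j _ (nbr-fib β q βi)))))
      nbr-steps (suc n) β βi q = begin
        nbr (shift i ([ suc n ] ⊗ κ i) β) q              ≡⟨ cong (λ z → nbr (shift i z β) q) ([suc]⊗ n (κ i)) ⟩
        nbr (shift i ([ n ] ⊗ κ i ⊕ κ i) β) q            ≡⟨ cong (λ z → nbr z q) (shift-shift i (κ i) _ β) ⟨
        nbr (step i (shift i ([ n ] ⊗ κ i) β)) q         ≡⟨ nbr-step _ q (shift-fib i _ β) ⟩
        shift j d (nbr (shift i ([ n ] ⊗ κ i) β) q)      ≡⟨ cong (shift j d) (nbr-steps n β βi q) ⟩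
        shift j d (shift j ([ n ] ⊗ d) (nbr β q))        ≡⟨ shift-shift j d _ _ ⟩
        shift j ([ n ] ⊗ d ⊕ d) (nbr β q)                ≡⟨ cong (λ z → shift j z (nbr β q)) ([suc]⊗ n d) ⟨
        shift j ([ suc n ] ⊗ d) (nbr β q)                ∎
        where open ≡-Reasoning

      common-nbrs : ∀ β β′ → fib β ≡ i → fib β′ ≡ i →
        count (λ q → ⌊ nbr β q F.≟ nbr β′ q ⌋) ≡ c u (star u) (r β β′)
      common-nbrs β β′ βi β′i = begin
        count (λ q → ⌊ nbr β q F.≟ nbr β′ q ⌋)
          ≡⟨ count-cong (λ q → ⌊⌋-⇔ (nbr β q F.≟ nbr β′ q) (r β′ (nbr β q) F.≟ u)
               (λ e → trans (cong (r β′) e) (nbr-rel β′ q β′i))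
               (rel⇒nbr β′ q _ (block-nbr β q βi))) ⟩
        count (λ q → ⌊ r β′ (nbr β q) F.≟ u ⌋)
          ≡⟨ count-nbr β βi (λ γ → ⌊ r β′ γ F.≟ u ⌋) ⟨
        count (λ γ → ⌊ r β γ F.≟ u ⌋ ∧ ⌊ r β′ γ F.≟ u ⌋)
          ≡⟨ count-cong (λ γ → cong (⌊ r β γ F.≟ u ⌋ ∧_) (⌊⌋-⇔ (r β′ γ F.≟ u) (r γ β′ F.≟ star u)
               r-star (λ e → trans (r-star e) (star-involutive u)))) ⟩
        count (λ γ → ⌊ r β γ F.≟ u ⌋ ∧ ⌊ r γ β′ F.≟ star u ⌋)
          ≡⟨ c-spec u (star u) β β′ ⟩
        c u (star u) (r β β′)
          ∎
        where open ≡-Reasoning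

      -- Shifting β′ inside its block shifts all its neighbours by multiples of d ≠ 0 without
      -- changing r β β′, so every shift x gives the same count c u u* (r β β′); these P counts add up to P.
      shifted-nbrs-meet-once : ∀ β β′ → fib β ≡ i → fib β′ ≡ i → ¬ block i β ≡ block i β′ → ∀ x →
        count (λ q → ⌊ nbr β q F.≟ shift j x (nbr β′ q) ⌋) ≡ 1
      shifted-nbrs-meet-once β β′ βi β′i β≁β′ x = trans (meets x) Λ≡1
        where
        Λ : ℕ
        Λ = c u (star u) (r β β′)
        meets : ∀ x → count (λ q → ⌊ nbr β q F.≟ shift j x (nbr β′ q) ⌋) ≡ Λ
        meets x =
          let n , nd≡x = ⊗-divide prime d twist≢0 x
              β″ = shift i ([ toℕ n ] ⊗ κ i) β′
              [n]d≡x : [ toℕ n ] ⊗ d ≡ x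
              [n]d≡x = trans (cong (_⊗ d) ([]-toℕ n)) nd≡x
          in trans (count-cong (λ q → cong (λ z → ⌊ nbr β q F.≟ z ⌋)
                     (trans (cong (λ z → shift j z (nbr β′ q)) (sym [n]d≡x)) (sym (nbr-steps (toℕ n) β′ β′i q)))))
               (trans (common-nbrs β β″ βi (shift-fib i _ β′))
                 (cong (c u (star u)) (r-other-block-constant i β β′ β″ βi β′i (shift-fib i _ β′)
                                         (β≁β′ ∘ cong (blockOf i)) (yc-shift i _ β′))))
        total : sum (λ x → count (λ q → ⌊ nbr β q F.≟ shift j x (nbr β′ q) ⌋)) ≡ P
        total = trans (count-comm (λ x q → ⌊ nbr β q F.≟ shift j x (nbr β′ q) ⌋))
          (trans (sum-cong-const _ 1 (λ q → count-shift≡1 j _ _ (nbr-fib β q βi) (nbr-fib β′ q β′i)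
                     (block≡⇒yc≡ j _ _ (trans (block-nbr β q βi) (sym (block-nbr β′ q β′i))))))
            (*-identityʳ P))
        Λ≡1 : Λ ≡ 1
        Λ≡1 = *-cancelˡ-≡ Λ 1 P (trans (sym (sum-cong-const _ Λ meets)) (trans total (sym (*-identityʳ P))))

  Compatible : I → I → Set
  Compatible i j = ∀ β δ → fib β ≡ i → fib δ ≡ j → r (step i β) (step j δ) ≡ r β δ

  compatible-from-point : ∀ i j α → fib α ≡ i →
    (∀ δ → fib δ ≡ j → r (step i α) (step j δ) ≡ r α δ) → Compatible i j
  compatible-from-point i j α αi at-α β δ βi δj =
    let δ′ , αδ′ = successor-exists {β} {δ} {α} refl (fib⇒diagonal (trans βi (sym αi)))
        δ′j = trans (r≡⇒target-fib αδ′) δj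
    in trans (r-shift² i j (κ i) (κ j) βi αi δj δ′j (sym αδ′)) (trans (at-α δ′ δ′j) αδ′)

  compatible-sym : ∀ i j → Compatible i j → Compatible j i
  compatible-sym i j ij δ β δj βi = r-flip (ij β δ βi δj)

  compatible-0 : ∀ j → ¬ j ≡ zero → Compatible zero j
  compatible-0 j j≢0 = compatible-from-point zero j a₀ (a-fib zero) at-a₀
    where
    a₀ : Fin N
    a₀ = a zero
    u : Fin M
    u = r a₀ (a j)
    open Neighbours zero j (j≢0 ∘ sym) u (r∈S (a-fib zero) (a-fib j))
    at-a₀ : ∀ δ → fib δ ≡ j → r (step zero a₀) (step j δ) ≡ r a₀ δ
    at-a₀ δ δj =
      let δ₀ = nbr a₀ (block j δ)
          δ₀j = nbr-fib a₀ _ (a-fib zero)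
          a₀δ₀ = nbr-rel a₀ _ (a-fib zero)
          e = xc j δ ⊝ xc j δ₀
          δ≡ : δ ≡ shift j e δ₀
          δ≡ = same-block⇒shift j δ₀ δ δ₀j δj (block≡⇒yc≡ j _ _ (block-nbr a₀ _ (a-fib zero)))
          at-δ₀ : r (step zero a₀) (step j δ₀) ≡ r a₀ δ₀
          at-δ₀ = trans (r-shift² zero j (κ zero) (κ j) (a-fib zero) (a-fib zero) δ₀j (a-fib j) a₀δ₀)
                        (trans (t-compatible j j≢0 _ _ (step-rel zero a₀ (a-fib zero)) (step-rel j (a j) (a-fib j)))
                               (sym a₀δ₀))
      in begin
        r (step zero a₀) (step j δ)              ≡⟨ cong (λ z → r (step zero a₀) (step j z)) δ≡ ⟩
        r (step zero a₀) (step j (shift j e δ₀)) ≡⟨ cong (r (step zero a₀)) (step-shift j e δ₀) ⟩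
        r (step zero a₀) (shift j e (step j δ₀)) ≡⟨ r-shiftʳ j e (shift-fib j _ δ₀) δ₀j at-δ₀ ⟩
        r a₀ (shift j e δ₀)                      ≡⟨ cong (r a₀) δ≡ ⟨
        r a₀ δ                                   ∎
      where open ≡-Reasoning

  -- For u ∈ S_jk the twist of u equals κ k. Otherwise, with s = r (a i) β, the number
  -- c_{s u}^{r (a i) ε} would be invariant under shifting ε by d ⊝ κ k ≠ 0, hence equal to 1
  -- on all of Ω_k; but two u-neighbourhoods of points of Ω_j in different blocks always meet.
  module Triangle (i j k : I) (i≢j : ¬ i ≡ j) (j≢k : ¬ j ≡ k)
    (ij : Compatible i j) (ik : Compatible i k)
    (β δ : Fin N) (βj : fib β ≡ j) (δk : fib δ ≡ k) where

    u : Fin M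
    u = r β δ
    module U = Neighbours j k j≢k u (r∈S βj δk)

    α : Fin N
    α = a i
    αi : fib α ≡ i
    αi = a-fib i
    s : Fin M
    s = r α β
    module S = Neighbours i j i≢j s (r∈S αi βj)

    s-twist : S.Twist (κ j)
    s-twist α′ γ e = trans (ij α′ γ (trans (r≡⇒source-fib e) αi) (trans (r≡⇒target-fib e) βj)) e
    module S′ = S.Twisted (κ j) s-twist

    paths : Fin N → ℕ
    paths ε = c s u (r α ε)

    paths-via-nbrs : ∀ α′ → fib α′ ≡ i → ∀ ε → c s u (r α′ ε) ≡ count (λ q → ⌊ r (S.nbr α′ q) ε F.≟ u ⌋)
    paths-via-nbrs α′ α′i ε = trans (sym (c-spec s u α′ ε)) (S.count-nbr α′ α′i (λ γ → ⌊ r γ ε F.≟ u ⌋))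

    module _ (d : Z) (twist : U.Twist d) (d≢κ : ¬ d ≡ κ k) where

      module U′ = U.Twisted d twist

      paths-shift-invariant : ∀ ε → fib ε ≡ k → paths (shift k (d ⊝ κ k) ε) ≡ paths ε
      paths-shift-invariant ε εk = begin
        c s u (r α (shift k (d ⊝ κ k) ε))
          ≡⟨ cong (c s u) α-shift ⟩
        c s u (r (step i α) (shift k d ε))
          ≡⟨ paths-via-nbrs (step i α) (shift-fib i _ α) (shift k d ε) ⟩
        count (λ q → ⌊ r (S.nbr (step i α) q) (shift k d ε) F.≟ u ⌋)
          ≡⟨ count-cong (λ q → trans (cong (λ z → ⌊ r z (shift k d ε) F.≟ u ⌋) (S′.nbr-step α q αi))
               (⌊⌋-⇔ (r (step j (S.nbr α q)) (shift k d ε) F.≟ u) (r (S.nbr α q) ε F.≟ u)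
                 (U′.twist⁻¹ _ ε (S.nbr-fib α q αi) εk) (twist _ ε))) ⟩
        count (λ q → ⌊ r (S.nbr α q) ε F.≟ u ⌋)
          ≡⟨ paths-via-nbrs α αi ε ⟨
        c s u (r α ε)
          ∎
        where
        open ≡-Reasoning
        α-shift : r α (shift k (d ⊝ κ k) ε) ≡ r (step i α) (shift k d ε)
        α-shift = trans (sym (ik α _ αi (shift-fib k _ ε)))
          (cong (r (step i α)) (trans (shift-shift k (κ k) _ ε) (cong (λ z → shift k z ε) (a⊝b⊕b≡a d (κ k)))))

      paths-block-constant : ∀ ε → fib ε ≡ k → ∀ x → paths (shift k x ε) ≡ paths ε
      paths-block-constant ε εk = ⊕-induction prime (λ x → paths (shift k x ε) ≡ paths ε) (d ⊝ κ k)
        (d≢κ ∘ ⊝≡0⇒≡ d (κ k)) (cong paths (shift-identity k ε εk))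
        (λ x e → trans (cong paths (sym (shift-shift k _ x ε))) (trans (paths-shift-invariant _ (shift-fib k x ε)) e))

      paths≡1 : ∀ ε → fib ε ≡ k → paths ε ≡ 1
      paths≡1 ε εk = begin
        paths ε                          ≡⟨ cong paths (point-offset k ε εk) ⟨
        paths (point k y e)              ≡⟨ on-block e ⟩
        paths ε₀                         ≡⟨ paths-block-start ⟩
        1                                ∎
        where
        open ≡-Reasoning
        y : Fin P
        y = block k ε
        e : Z
        e = offset k ε
        ε₀ : Fin N
        ε₀ = point k y 0z
        on-block : ∀ x → paths (point k y x) ≡ paths ε₀
        on-block x = trans (cong paths (trans (cong (point k y) (sym (⊕-identityˡ x))) (sym (shift-point k y 0z x))))
                           (paths-block-constant ε₀ (point-fib k y 0z) _)
        one-per-nbr : ∀ q → count (λ x → ⌊ r (S.nbr α q) (point k y x) F.≟ u ⌋) ≡ 1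
        one-per-nbr q =
          let γ = S.nbr α q ; γj = S.nbr-fib α q αi
          in count≡1 _ (offset k (U.nbr γ y))
               (λ x e → point-injective k y x _ (trans (U.rel⇒nbr γ y _ (block-point k y x) (⌊⌋≡true⁻¹ (r γ _ F.≟ u) e))
                                                      (U.nbr≡point γ y γj)))
               (⌊⌋≡true (r γ _ F.≟ u) (trans (cong (r γ) (sym (U.nbr≡point γ y γj))) (U.nbr-rel γ y γj)))
        paths-block-start : paths ε₀ ≡ 1
        paths-block-start = *-cancelˡ-≡ _ 1 P (begin
          P * paths ε₀                            ≡⟨ sum-cong-const _ _ on-block ⟨
          sum (λ x → paths (point k y x))         ≡⟨ sum-cong-≗ (λ x → paths-via-nbrs α αi (point k y x)) ⟩
          sum (λ x → count (λ q → path-via x q)) ≡⟨ count-comm path-via ⟩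
          sum (λ q → count (λ x → path-via x q)) ≡⟨ sum-cong-const _ 1 one-per-nbr ⟩
          P * 1                                   ∎)
          where
          path-via : Z → Fin P → Bool
          path-via x q = ⌊ r (S.nbr α q) (point k y x) F.≟ u ⌋

      common-u-nbr : ⊥
      common-u-nbr =
        let y , ey = count>0⇒∃ (λ y → ⌊ U.nbr γ₀ y F.≟ shift k 0z (U.nbr γ₁ y) ⌋)
                       (subst (0 <_) (sym (U′.shifted-nbrs-meet-once γ₀ γ₁ γ₀j γ₁j different-blocks 0z)) (s≤s z≤n))
            ε = U.nbr γ₀ y
            ε≡ : ε ≡ U.nbr γ₁ y
            ε≡ = trans (⌊⌋≡true⁻¹ (ε F.≟ _) ey) (shift-identity k _ (U.nbr-fib γ₁ y γ₁j))
            one = trans (sym (paths-via-nbrs α αi ε)) (paths≡1 ε (U.nbr-fib γ₀ y γ₀j))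
        in contradiction (count≡1⇒unique (λ q → ⌊ r (S.nbr α q) ε F.≟ u ⌋) one q₀ q₁
             (⌊⌋≡true (r γ₀ ε F.≟ u) (U.nbr-rel γ₀ y γ₀j))
             (⌊⌋≡true (r γ₁ ε F.≟ u) (trans (cong (r γ₁) ε≡) (U.nbr-rel γ₁ y γ₁j)))) λ ()
        where
        q₀ q₁ : Fin P
        q₀ = zero
        q₁ = suc zero
        γ₀ γ₁ : Fin N
        γ₀ = S.nbr α q₀
        γ₁ = S.nbr α q₁
        γ₀j : fib γ₀ ≡ j
        γ₀j = S.nbr-fib α q₀ αi
        γ₁j : fib γ₁ ≡ j
        γ₁j = S.nbr-fib α q₁ αi
        different-blocks : ¬ block j γ₀ ≡ block j γ₁
        different-blocks e = contradiction (trans (sym (S.block-nbr α q₀ αi)) (trans e (S.block-nbr α q₁ αi))) λ ()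

    twist≡κ : ∀ d → U.Twist d → d ≡ κ k
    twist≡κ d twist with d F.≟ κ k
    ... | yes d≡κ = d≡κ
    ... | no  d≢κ = ⊥-elim (common-u-nbr d twist d≢κ)

    compatible-at : r (step j β) (step k δ) ≡ r β δ
    compatible-at = let d , twist = U.twist-exists in
      trans (cong (λ z → r (step j β) (shift k z δ)) (sym (twist≡κ d twist))) (twist β δ refl)

  compatible : ∀ i j → ¬ i ≡ j → Compatible i j
  compatible i j i≢j with i F.≟ zero | j F.≟ zero
  ... | yes refl | _        = compatible-0 j (i≢j ∘ sym)
  ... | no i≢0   | yes refl = compatible-sym zero i (compatible-0 i i≢0)
  ... | no i≢0   | no j≢0   = λ β δ βi δj →
    Triangle.compatible-at zero i j (i≢0 ∘ sym) i≢j (compatible-0 i i≢0) (compatible-0 j j≢0) β δ βi δj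

  compatible-steps : ∀ i j → Compatible i j → ∀ β δ → fib β ≡ i → fib δ ≡ j → ∀ h →
    r (shift i (h ⊗ κ i) β) (shift j (h ⊗ κ j) δ) ≡ r β δ
  compatible-steps i j ij β δ βi δj h =
    subst (λ z → r (shift i (z ⊗ κ i) β) (shift j (z ⊗ κ j) δ) ≡ r β δ) ([]-toℕ h) (steps (toℕ h))
    where
    steps : ∀ n → r (shift i ([ n ] ⊗ κ i) β) (shift j ([ n ] ⊗ κ j) δ) ≡ r β δ
    steps zero =
      trans (cong₂ (λ z w → r (shift i z β) (shift j w δ)) ([0]⊗ (κ i)) ([0]⊗ (κ j)))
            (cong₂ r (shift-identity i β βi) (shift-identity j δ δj))
    steps (suc n) =
      trans (cong₂ (λ z w → r (shift i z β) (shift j w δ)) ([suc]⊗ n (κ i)) ([suc]⊗ n (κ j)))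
        (trans (cong₂ r (sym (shift-shift i (κ i) _ β)) (sym (shift-shift j (κ j) _ δ)))
          (trans (ij _ _ (shift-fib i _ β) (shift-fib j _ δ)) (steps n)))

  IsH⇒rel : ∀ i j s (h : Fin P → Fin P → Z) → IsH X (rep i) (rep j) (t j) s h →
    ∀ x q → r (rep i x) (point j q (h x q)) ≡ s
  IsH⇒rel i j s h H x q =
    let γ , pow , xγ = H x q
        γ≡ = Pow⇒shift j (toℕ (h x q)) (rep j q) γ (rep-fib j q) pow
    in trans (cong (r (rep i x)) (sym (trans γ≡ (cong (λ z → shift j (z ⊗ κ j) (rep j q)) ([]-toℕ (h x q)))))) xγ

  module Product (i j k : I) (i≢j : ¬ i ≡ j) (j≢k : ¬ j ≡ k)
    (s₁ s₂ s₃ : Fin M) (s₁∈S : In-S X fib i j s₁) (s₂∈S : In-S X fib j k s₂)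
    (h₁ h₂ h₃ : Fin P → Fin P → Z)
    (H₁ : IsH X (rep i) (rep j) (t j) s₁ h₁) (H₂ : IsH X (rep j) (rep k) (t k) s₂ h₂)
    (H₃ : IsH X (rep i) (rep k) (t k) s₃ h₃) where

    module S₁ = Neighbours i j i≢j s₁ s₁∈S
    module S₂ = Neighbours j k j≢k s₂ s₂∈S

    jk : Compatible j k
    jk = compatible j k j≢k

    module S₂′ = S₂.Twisted (κ k) (λ β γ e → trans (jk β γ (proj₁ (s₂∈S β γ e)) (proj₂ (s₂∈S β γ e))) e)

    s₂-from : ∀ x q y → r (point j q (h₁ x q)) (point k y (h₂ q y ⊕ h₁ x q)) ≡ s₂
    s₂-from x q y = trans (cong (r (point j q (h₁ x q))) (sym (shift-point k y (h₂ q y) (h₁ x q))))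
      (trans (compatible-steps j k jk (rep j q) (point k y (h₂ q y)) (rep-fib j q) (point-fib k y _) (h₁ x q))
             (IsH⇒rel j k s₂ h₂ H₂ q y))

    s₂-from⁻¹ : ∀ x q y e → r (point j q (h₁ x q)) (point k y e) ≡ s₂ → e ≡ h₂ q y ⊕ h₁ x q
    s₂-from⁻¹ x q y e rel = point-injective k y _ _
      (CrossRelation.meets-block-once j k j≢k s₂ s₂∈S (point j q (h₁ x q)) _ _ rel (s₂-from x q y)
        (trans (yc-point k y e) (sym (yc-point k y _))))

    nbr₁ : ∀ x q → S₁.nbr (rep i x) q ≡ point j q (h₁ x q)
    nbr₁ x q = sym (S₁.rel⇒nbr (rep i x) q _ (block-point j q _) (IsH⇒rel i j s₁ h₁ H₁ x q))

    nbr₂ : ∀ q y → S₂.nbr (rep j q) y ≡ point k y (h₂ q y)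
    nbr₂ q y = sym (S₂.rel⇒nbr (rep j q) y _ (block-point k y _) (IsH⇒rel j k s₂ h₂ H₂ q y))

    -- The coefficient of ξ^e in α: s₁s₂-paths from α_{i0} to the point of α_{i0} s₃ shifted by e steps of t_k.
    C : Z → ℕ
    C e = c s₁ s₂ (r (rep i zero) (point k zero (h₃ zero zero ⊕ e)))

    rel-independent : ∀ x y e → r (rep i x) (point k y (h₃ x y ⊕ e)) ≡ r (rep i zero) (point k zero (h₃ zero zero ⊕ e))
    rel-independent x y e =
      trans (cong (r (rep i x)) (sym (shift-point k y (h₃ x y) e)))
        (trans (r-shiftʳ k (e ⊗ κ k) (point-fib k y _) (point-fib k zero _)
                 (trans (IsH⇒rel i k s₃ h₃ H₃ x y) (sym (IsH⇒rel i k s₃ h₃ H₃ zero zero))))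
               (cong (r (rep i zero)) (shift-point k zero (h₃ zero zero) e)))

    paths-count : ∀ x y e → count (λ q → ⌊ h₃ x y ⊕ e F.≟ h₂ q y ⊕ h₁ x q ⌋) ≡ C e
    paths-count x y e = begin
      count (λ q → ⌊ h₃ x y ⊕ e F.≟ h₂ q y ⊕ h₁ x q ⌋)
        ≡⟨ count-cong (λ q → ⌊⌋-⇔ (h₃ x y ⊕ e F.≟ h₂ q y ⊕ h₁ x q) (r (S₁.nbr (rep i x) q) ε F.≟ s₂)
             (λ e≡ → trans (cong₂ r (nbr₁ x q) (cong (point k y) e≡)) (s₂-from x q y))
             (λ rel → s₂-from⁻¹ x q y _ (trans (cong (λ z → r z ε) (sym (nbr₁ x q))) rel))) ⟩
      count (λ q → ⌊ r (S₁.nbr (rep i x) q) ε F.≟ s₂ ⌋)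
        ≡⟨ S₁.count-nbr (rep i x) (rep-fib i x) (λ γ → ⌊ r γ ε F.≟ s₂ ⌋) ⟨
      count (λ γ → ⌊ r (rep i x) γ F.≟ s₁ ⌋ ∧ ⌊ r γ ε F.≟ s₂ ⌋)
        ≡⟨ c-spec s₁ s₂ (rep i x) ε ⟩
      c s₁ s₂ (r (rep i x) ε)
        ≡⟨ cong (c s₁ s₂) (rel-independent x y e) ⟩
      C e
        ∎
      where
      open ≡-Reasoning
      ε : Fin N
      ε = point k y (h₃ x y ⊕ e)

    h₂-rows-meet-once : ∀ q q′ → ¬ q ≡ q′ → ∀ z → count (λ y → ⌊ h₂ q y F.≟ h₂ q′ y ⊕ z ⌋) ≡ 1
    h₂-rows-meet-once q q′ q≢q′ z =
      trans (count-cong (λ y → ⌊⌋-⇔ (h₂ q y F.≟ h₂ q′ y ⊕ z) (nbr q y F.≟ shift k z′ (nbr q′ y)) (to y) (from y)))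
        (S₂′.shifted-nbrs-meet-once (rep j q) (rep j q′) (rep-fib j q) (rep-fib j q′)
          (λ e → q≢q′ (trans (sym (blockOf-yr j q)) (trans e (blockOf-yr j q′)))) z′)
      where
      z′ : Z
      z′ = z ⊗ κ k
      nbr : Fin P → Fin P → Fin N
      nbr q y = S₂.nbr (rep j q) y
      shifted : ∀ y → shift k z′ (nbr q′ y) ≡ point k y (h₂ q′ y ⊕ z)
      shifted y = trans (cong (shift k z′) (nbr₂ q′ y)) (shift-point k y (h₂ q′ y) z)
      to : ∀ y → h₂ q y ≡ h₂ q′ y ⊕ z → nbr q y ≡ shift k z′ (nbr q′ y)
      to y e = trans (nbr₂ q y) (trans (cong (point k y) e) (sym (shifted y)))
      from : ∀ y → nbr q y ≡ shift k z′ (nbr q′ y) → h₂ q y ≡ h₂ q′ y ⊕ z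
      from y e = point-injective k y _ _ (trans (sym (nbr₂ q y)) (trans e (shifted y)))

    C-autocorrelation : ∀ e → sum (λ d → C d * C (d ⊝ e)) ≡ δ₀ e + suc p′
    C-autocorrelation = autocorrelation C (λ y q → h₂ q y ⊕ h₁ zero q) (h₃ zero) (λ y → paths-count zero y)
      (λ q q′ q≢q′ e → trans (count-cong (λ y → ⌊⌋-⇔ (h₂ q y ⊕ h₁ zero q ⊝ e F.≟ h₂ q′ y ⊕ h₁ zero q′)
                                         (h₂ q y F.≟ h₂ q′ y ⊕ (h₁ zero q′ ⊕ e ⊝ h₁ zero q))
                                         (⊕⊝≡⊕⇒ _ _ _ _ e) (⇒⊕⊝≡⊕ _ _ _ _ e)))
                           (h₂-rows-meet-once q q′ q≢q′ _))

    product-entry : ∀ x y e → count (λ q → ⌊ e ⊝ h₁ x q F.≟ h₂ q y ⌋) ≡ C (e ⊝ h₃ x y)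
    product-entry x y e =
      trans (count-cong λ q → ⌊⌋-⇔ (e ⊝ h₁ x q F.≟ h₂ q y) (h₃ x y ⊕ (e ⊝ h₃ x y) F.≟ h₂ q y ⊕ h₁ x q)
              (λ e≡ → trans (a⊕[b⊝a]≡b (h₃ x y) e) (⊝≡⇒≡⊕ e≡))
              (λ e≡ → ≡⊕⇒⊝≡ (trans (sym (a⊕[b⊝a]≡b (h₃ x y) e)) e≡)))
            (paths-count x y (e ⊝ h₃ x y))

    H-product : ∃ λ (α : Zξ P) → AbsIsSqrtP P α ×
      (∀ x y → _≈ξ_ P (_·M_ P (Hmat P h₁) (Hmat P h₂) x y) (_*ξ_ P α (Hmat P h₃ x y)))
    H-product = +_ ∘ C , norm , product
      where
      norm : AbsIsSqrtP P (+_ ∘ C)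
      norm = + suc p′ , λ e → trans (*ξ-conjξ C e) (trans (cong +_ (C-autocorrelation e)) (sym (constξ-+ e (suc p′))))
      product : ∀ x y → _≈ξ_ P (_·M_ P (Hmat P h₁) (Hmat P h₂) x y) (_*ξ_ P (+_ ∘ C) (Hmat P h₃ x y))
      product x y = + 0 , λ e → begin
        _·M_ P (Hmat P h₁) (Hmat P h₂) x y e        ≡⟨ Hmat-product h₁ h₂ x y e ⟩
        + count (λ q → ⌊ e ⊝ h₁ x q F.≟ h₂ q y ⌋)   ≡⟨ cong +_ (product-entry x y e) ⟩
        + C (e ⊝ h₃ x y)                            ≡⟨ *ξ-ξ^ C (h₃ x y) e ⟨
        _*ξ_ P (+_ ∘ C) (Hmat P h₃ x y) e           ≡⟨ ℤP.+-identityʳ _ ⟨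
        _*ξ_ P (+_ ∘ C) (Hmat P h₃ x y) e ℤ.+ + 0  ∎
        where open ≡-Reasoning

proposition3p2 :
  (p : ℕ) .{{_ : NonZero p}} → Prime p →
  (N M m : ℕ) (X : CoherentConfiguration N M) →
  let open CoherentConfiguration X in
  (fib : Fin N → Fin (suc m)) → IsFiberLabelling X (suc m) fib →
  -- (Ω_i , S_i) ≃ C_p ≀ C_p
  (∀ i → Σ (Fin p × Fin p → Fin N) λ f →
     (∀ x → fib (f x) ≡ i) × Injective _≡_ _≡_ f ×
     (∀ α → fib α ≡ i → ∃ λ x → f x ≡ α) ×
     (∀ x y x′ y′ → (r (f x) (f y) ≡ r (f x′) (f y′)) ⇔ SameWrRel p x y x′ y′)) →
  -- n_s = p for s ∈ S_ij, i ≠ j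
  (∀ i j → ¬ i ≡ j → ∀ s → In-S X fib i j s →
     ∀ α → fib α ≡ i → valency-at X α s ≡ p) →
  -- S = ⋃ S_i ∪ (S ∖ R)
  (∀ s → (∃ λ i → In-S X fib i i s) ⊎ ¬ Regular X s) →
  -- α_i ∈ Ω_i
  (a : Fin (suc m) → Fin N) → (∀ i → fib (a i) ≡ i) →
  -- t_i ∈ O_θ(S_i), t_1 ≠ 1_{Ω_1}, r(α_1 t_1, α_i t_i) = r(α_1, α_i)
  (t : Fin (suc m) → Fin M) → (∀ i → InOθ X fib i (t i)) →
  ¬ t zero ≡ r (a zero) (a zero) →
  (∀ i → ¬ i ≡ zero → ∀ γ δ → r (a zero) γ ≡ t zero → r (a i) δ ≡ t i →
     r γ δ ≡ r (a zero) (a i)) →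
  -- α_{ik}: complete set of representatives of ⋃_{t ∈ O_θ(S_i)} t
  (rep : Fin (suc m) → Fin p → Fin N) → (∀ i k → fib (rep i k) ≡ i) →
  (∀ i β → fib β ≡ i →
     ∃ λ k → InOθ X fib i (r (rep i k) β) ×
             (∀ k′ → InOθ X fib i (r (rep i k′) β) → k′ ≡ k)) →
  -- conclusion
  ∀ i j k → ¬ i ≡ j → ¬ j ≡ k → ¬ i ≡ k →
  ∀ s₁ s₂ s₃ → In-S X fib i j s₁ → In-S X fib j k s₂ → In-S X fib i k s₃ →
  ∀ h₁ h₂ h₃ →
  IsH X (rep i) (rep j) (t j) s₁ h₁ →
  IsH X (rep j) (rep k) (t k) s₂ h₂ →
  IsH X (rep i) (rep k) (t k) s₃ h₃ →
  ∃ λ (α : Zξ p) → AbsIsSqrtP p α ×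
    (∀ x y → _≈ξ_ p (_·M_ p (Hmat p h₁) (Hmat p h₂) x y) (_*ξ_ p α (Hmat p h₃ x y)))
proposition3p2 0 pr = contradiction pr ¬prime[0]
proposition3p2 1 pr = contradiction pr ¬prime[1]
proposition3p2 (suc (suc p′)) pr N M m X fib fibres chart valency non-regular a a-fib t t-thin t₀≢1 t-compatible
  rep rep-fib rep-classes i j k i≢j j≢k _ s₁ s₂ s₃ s₁∈S s₂∈S _ h₁ h₂ h₃ H₁ H₂ H₃ =
  Setting.Product.H-product p′ pr m X fib fibres chart valency non-regular a a-fib t t-thin t₀≢1 t-compatible
    rep rep-fib rep-classes i j k i≢j j≢k s₁ s₂ s₃ s₁∈S s₂∈S h₁ h₂ h₃ H₁ H₂ H₃
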